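{- Let $G$ be a finite simple connected undirected graph on $V=\{1,\dots,n\}$ with $m$ edges, every vertex of degree at least $2$, and $G$ not a cycle, and suppose the NBRW on $G$ has locally uniform return time. Then \[ Z^{(nb)}_vD^{ -1}T(I-P_{nb})M^{(nb)}_{ev}=D^{ -1}TZ^{(nb)}_e(I-P_{nb})M^{(nb)}_{ev}. \]
   Context: $d_i=\deg(i)$, $D=\mathrm{diag}(d_i)$. Directed edges: the $2m$ ordered pairs $(i,j)$ with $\{i,j\}$ an edge. $P_{nb}((i,j),(k,\ell))=\frac1{d_j-1}$ if $j=k,\ell\ne i$, else $0$. $S$ ($2m\times n$): $S((i,j),x)=1$ iff $j=x$; $T$ ($n\times2m$): $T(x,(i,j))=1$ iff $i=x$. $\pi_i=d_i/(2m)$, $\pi_e=\frac1{2m}\mathbb 1$, $W_v=\mathbb 1\pi^\top$, $W_e=\mathbb 1\pi_e^\top$. $Z^{(nb)}_e=(I-P_{nb}+W_e)^{ -1}$, $Z^{(nb)}_v=D^{ -1}TZ^{(nb)}_eT^\top=I+D^{ -1}TZ^{(nb)}_eS-W_v$. NBRW on vertices: $\tilde X_1$ uniform neighbor of $\tilde X_0$; for $k\ge1$, $\tilde X_{k+1}$ uniform among neighbors of $\tilde X_k$ other than $\tilde X_{k-1}$. $\tilde T_v=\min\{k\ge0:\tilde X_k=v\}$, $\tilde T^+_v=\min\{k\ge1:\tilde X_k=v\}$. $M^{(nb)}_{ev}$ is $2m\times n$ with entries $\mathbb E[\tilde T_v\mid\tilde X_0=i,\tilde X_1=j]$. Locally uniform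 return time: for every vertex $i$, $\mathbb E[\tilde T_i^+\mid\tilde X_0=i,\tilde X_1=j]$ is independent of the neighbor $j$. -}

module Defs where

open import Data.Bool using (Bool; true; false; T; if_then_else_)
open import Data.Nat as ℕ using (ℕ; zero; suc; _∸_)
open import Data.Fin using (Fin; toℕ; _≟_)
open import Data.Fin.Permutation using (Permutation′)
open import Data.Integer using (+_)
open import Data.Rational using (ℚ; 0ℚ; 1ℚ; _+_; _*_; _-_; _<_; ∣_∣; _/_)
open import Data.Product using (Σ; _×_; _,_; proj₁; proj₂; ∃)
open import Data.Sum using (_⊎_)
open import Data.Unit using (tt)
open import Function.Bundles using (Inverse)
open import Relation.Nullary using (¬_; yes; no)
open import Relation.Binary.PropositionalEquality using (_≡_)

ℕ→ℚ : ℕ → ℚ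
ℕ→ℚ k = + k / 1

-- reciprocal of a natural number (1/k for k ≥ 1; 0 for k = 0, never used
-- under the standing hypotheses: all degrees ≥ 2, so d_j - 1 ≥ 1, m ≥ 1)
recip : ℕ → ℚ
recip zero    = 0ℚ
recip (suc k) = + 1 / suc k

sumFin : ∀ {n} → (Fin n → ℚ) → ℚ
sumFin {zero}  f = 0ℚ
sumFin {suc n} f = f Data.Fin.zero + sumFin (λ i → f (Data.Fin.suc i))

sumIf : (b : Bool) → (T b → ℚ) → ℚ
sumIf true  f = f tt
sumIf false f = 0ℚ

partial : (ℕ → ℚ) → ℕ → ℚ
partial s zero    = s zero
partial s (suc K) = partial s K + s (suc K)

SeriesSum : (ℕ → ℚ) → ℚ → Set
SeriesSum s L = ∀ (ε : ℚ) → 0ℚ < ε →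
  ∃ λ N → ∀ K → N ℕ.≤ K → ∣ partial s K - L ∣ < ε

[_≟ᶠ_] : ∀ {n} → Fin n → Fin n → ℚ
[ a ≟ᶠ b ] with a ≟ b
... | yes _ = 1ℚ
... | no  _ = 0ℚ

Mat : Set → Set → Set
Mat A B = A → B → ℚ

Graph : ℕ → Set
Graph n = Fin n → Fin n → Bool

module _ {n : ℕ} (G : Graph n) where

  IsSimple : Set
  IsSimple = (∀ i j → G i j ≡ G j i) × (∀ i → G i i ≡ false)

  data Reach : Fin n → Fin n → Set where
    here : ∀ {u} → Reach u u
    step : ∀ {u w v} → T (G u w) → Reach w v → Reach u v

  Connected : Set
  Connected = ∀ u v → Reach u v

  deg : Fin n → ℕ
  deg i = count (λ j → G i j)
    where
    count : ∀ {k} → (Fin k → Bool) → ℕ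
    count {zero}  f = zero
    count {suc k} f = (if f Data.Fin.zero then 1 else 0) ℕ.+ count (λ x → f (Data.Fin.suc x))

  MinDegTwo : Set
  MinDegTwo = ∀ i → 2 ℕ.≤ deg i

  -- G is (isomorphic to) the cycle C_n : vertices σ(0), …, σ(n-1) with
  -- σ(a) ~ σ(b) iff b ≡ a ± 1 (mod n), n ≥ 3
  IsCycle : Set
  IsCycle = (3 ℕ.≤ n) × Σ (Permutation′ n) λ σ →
    ∀ a b → (T (G (Inverse.to σ a) (Inverse.to σ b)) → CycAdj a b)
          × (CycAdj a b → T (G (Inverse.to σ a) (Inverse.to σ b)))
    where
    Succ : Fin n → Fin n → Set
    Succ a b = (suc (toℕ a) ≡ toℕ b) ⊎ ((suc (toℕ a) ≡ n) × (toℕ b ≡ 0))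
    CycAdj : Fin n → Fin n → Set
    CycAdj a b = Succ a b ⊎ Succ b a

  twoM : ℕ
  twoM = sumℕ deg
    where
    sumℕ : ∀ {k} → (Fin k → ℕ) → ℕ
    sumℕ {zero}  f = zero
    sumℕ {suc k} f = f Data.Fin.zero ℕ.+ sumℕ (λ x → f (Data.Fin.suc x))

  DE : Set
  DE = Σ (Fin n × Fin n) λ p → T (G (proj₁ p) (proj₂ p))

  tail head : DE → Fin n
  tail e = proj₁ (proj₁ e)
  head e = proj₂ (proj₁ e)

  sumDE : (DE → ℚ) → ℚ
  sumDE f = sumFin λ i → sumFin λ j → sumIf (G i j) (λ p → f ((i , j) , p))

  _·ᵥ_ : ∀ {A C : Set} → Mat A (Fin n) → Mat (Fin n) C → Mat A C
  (X ·ᵥ Y) a c = sumFin λ k → X a k * Y k c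

  _·ₑ_ : ∀ {A C : Set} → Mat A DE → Mat DE C → Mat A C
  (X ·ₑ Y) a c = sumDE λ k → X a k * Y k c

  infixl 7 _·ᵥ_ _·ₑ_

  -- identity and W_e = 𝟙 π_eᵀ on directed edges, π_e = (1/2m) 𝟙
  Iₑ : Mat DE DE
  Iₑ e f = [ tail e ≟ᶠ tail f ] * [ head e ≟ᶠ head f ]

  Wₑ : Mat DE DE
  Wₑ e f = recip twoM

  Pnb : Mat DE DE
  Pnb e f = [ head e ≟ᶠ tail f ] * (1ℚ - [ head f ≟ᶠ tail e ]) * recip (deg (head e) ∸ 1)

  IminusP : Mat DE DE
  IminusP e f = Iₑ e f - Pnb e f

  IminusPplusW : Mat DE DE
  IminusPplusW e f = Iₑ e f - Pnb e f + Wₑ e f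

  IsZe : Mat DE DE → Set
  IsZe Z = (∀ e f → (IminusPplusW ·ₑ Z) e f ≡ Iₑ e f)
         × (∀ e f → (Z ·ₑ IminusPplusW) e f ≡ Iₑ e f)

  Tm : Mat (Fin n) DE
  Tm x e = [ tail e ≟ᶠ x ]

  Tmᵀ : Mat DE (Fin n)
  Tmᵀ e x = Tm x e

  Dinv : Mat (Fin n) (Fin n)
  Dinv x y = [ x ≟ᶠ y ] * recip (deg x)

  Zv : Mat DE DE → Mat (Fin n) (Fin n)
  Zv Z = Dinv ·ᵥ Tm ·ₑ Z ·ₑ Tmᵀ

  -- Given (X̃₀,X̃₁) = (i,j), the pair (X̃₁,X̃₂) has law P_nb((i,j),·) and the
  -- walk from time 1 on is again the NBRW started from (X̃₁,X̃₂).

  -- hitProb v k e = P( T̃_v = k | (X̃₀,X̃₁) = e ),  T̃_v = min{k ≥ 0 : X̃_k = v}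
  hitProb : Fin n → ℕ → DE → ℚ
  hitProb v zero    e = [ tail e ≟ᶠ v ]
  hitProb v (suc k) e = (1ℚ - [ tail e ≟ᶠ v ]) * sumDE (λ f → Pnb e f * hitProb v k f)

  -- retProb k e = P( T̃⁺_i = k | (X̃₀,X̃₁) = e ), i = tail e,
  -- T̃⁺_i = min{k ≥ 1 : X̃_k = i}
  retProb : ℕ → DE → ℚ
  retProb zero    e = 0ℚ
  retProb (suc k) e = sumDE (λ f → Pnb e f * hitProb (tail e) k f)

  IsMev : Mat DE (Fin n) → Set
  IsMev M = ∀ e v → SeriesSum (λ k → ℕ→ℚ k * hitProb v k e) (M e v)

  IsReturnTimes : (DE → ℚ) → Set
  IsReturnTimes R = ∀ e → SeriesSum (λ k → ℕ→ℚ k * retProb k e) (R e)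

  LocallyUniformReturn : Set
  LocallyUniformReturn = ∀ (R : DE → ℚ) → IsReturnTimes R →
    ∀ (e f : DE) → tail e ≡ tail f → R e ≡ R f

module Submission where

-- Write B = D⁻¹T and Π = Tᵀ D⁻¹ T, so that Z_v D⁻¹ T = B Z_e Π.  Row e of Π averages over the
-- directed edges with the tail of e, so the identity holds once the rows of Y = (I - P_nb) M are
-- constant on tail classes.  First-step analysis gives Y(e, v) = 1 for tail e ≠ v, and
-- Y(e, tail e) = 1 - R(e) with R(e) = Σ_f P_nb(e, f) (M(f, tail e) + 1), the sum of the return-time
-- series; by the locally uniform return time R(e) depends only on tail e.  First-step analysis of
-- the series needs the walk to hit every vertex almost surely: G is connected with all degrees ≥ 2,
-- so from every directed edge a non-backtracking path of length at most some N leads to any vertex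
-- v, each of its steps has probability ≥ 1/n, and the walk avoids v up to time k(N+1) with
-- probability at most (1 - n⁻ᴺ)ᵏ.

open import Defs
open import Data.Nat using (ℕ)
open import Data.Fin using (Fin)
open import Relation.Nullary using (¬_)
open import Relation.Binary.PropositionalEquality using (_≡_)

open import Algebra.Bundles using (CommutativeRing)
open import Data.Bool using (Bool; true; false; T; if_then_else_)
open import Data.Empty using (⊥-elim)
open import Data.Fin using (zero; suc; _≟_; toℕ)
open import Data.Fin.Properties using (suc-injective; pigeonhole)
import Data.Integer as ℤ
import Data.Integer.Properties as ℤₚ
open import Data.Nat as ℕ using (zero; suc; _∸_)
import Data.Nat.Properties as ℕₚ
open import Data.Nat.Coprimality using (1-coprimeTo)
import Data.Nat.Coprimality as Coprime
open import Data.Product using (Σ; ∃; ∃₂; _×_; _,_; proj₁; proj₂)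
open import Data.Rational hiding (_≟_)
open import Data.Rational.Properties hiding (_≟_)
open import Data.Rational.Solver using (module +-*-Solver)
open import Data.Sum using (_⊎_; inj₁; inj₂)
open import Data.Unit using (tt)
open import Relation.Binary.Construct.Closure.ReflexiveTransitive as Star using (Star; _◅_; _◅◅_)
open import Relation.Binary.Definitions using (tri<; tri≈; tri>)
open import Relation.Binary.PropositionalEquality
  using (refl; sym; trans; cong; cong₂; subst; subst₂; module ≡-Reasoning)
open import Relation.Nullary using (Dec; yes; no)

open import Algebra.Properties.Semiring.Sum (CommutativeRing.semiring +-*-commutativeRing)
  using (sum; ∑-distrib-+; ∑-comm; *-distribˡ-sum)
open import Algebra.Definitions.RawSemiring +-*-rawSemiring using (_^_)
open import Algebra.Properties.Group +-0-group using (x∙y⁻¹≈ε⇒x≈y)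

open +-*-Solver

sumFin-cong : ∀ {m} {f g : Fin m → ℚ} → (∀ i → f i ≡ g i) → sumFin f ≡ sumFin g
sumFin-cong {zero}  f≗g = refl
sumFin-cong {suc m} f≗g = cong₂ _+_ (f≗g zero) (sumFin-cong (λ i → f≗g (suc i)))

sumFin≡sum : ∀ {m} (f : Fin m → ℚ) → sumFin f ≡ sum f
sumFin≡sum {zero}  f = refl
sumFin≡sum {suc m} f = cong (f zero +_) (sumFin≡sum (λ i → f (suc i)))

sumFin-+ : ∀ {m} (f g : Fin m → ℚ) → sumFin (λ i → f i + g i) ≡ sumFin f + sumFin g
sumFin-+ f g = begin
  sumFin (λ i → f i + g i) ≡⟨ sumFin≡sum (λ i → f i + g i) ⟩
  sum (λ i → f i + g i)    ≡⟨ ∑-distrib-+ f g ⟩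
  sum f + sum g            ≡⟨ sym (cong₂ _+_ (sumFin≡sum f) (sumFin≡sum g)) ⟩
  sumFin f + sumFin g      ∎
  where open ≡-Reasoning

sumFin-*ˡ : ∀ {m} c (f : Fin m → ℚ) → sumFin (λ i → c * f i) ≡ c * sumFin f
sumFin-*ˡ c f = begin
  sumFin (λ i → c * f i) ≡⟨ sumFin≡sum (λ i → c * f i) ⟩
  sum (λ i → c * f i)    ≡⟨ sym (*-distribˡ-sum c f) ⟩
  c * sum f              ≡⟨ cong (c *_) (sym (sumFin≡sum f)) ⟩
  c * sumFin f           ∎
  where open ≡-Reasoning

sumFin-comm : ∀ {m k} (f : Fin m → Fin k → ℚ) →
  sumFin (λ i → sumFin (λ j → f i j)) ≡ sumFin (λ j → sumFin (λ i → f i j))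
sumFin-comm f = begin
  sumFin (λ i → sumFin (λ j → f i j)) ≡⟨ sumFin²≡sum² f ⟩
  sum (λ i → sum (λ j → f i j))       ≡⟨ ∑-comm f ⟩
  sum (λ j → sum (λ i → f i j))       ≡⟨ sym (sumFin²≡sum² (λ j i → f i j)) ⟩
  sumFin (λ j → sumFin (λ i → f i j)) ∎
  where
  open ≡-Reasoning
  sumFin²≡sum² : ∀ {a b} (g : Fin a → Fin b → ℚ) →
    sumFin (λ i → sumFin (g i)) ≡ sum (λ i → sum (g i))
  sumFin²≡sum² g = trans (sumFin-cong (λ i → sumFin≡sum (g i))) (sumFin≡sum (λ i → sum (g i)))

sumFin-zero : ∀ {m} → sumFin {m} (λ _ → 0ℚ) ≡ 0ℚ
sumFin-zero {zero}  = refl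
sumFin-zero {suc m} = cong (0ℚ +_) (sumFin-zero {m})

δ-≡ : ∀ {m} {a b : Fin m} → a ≡ b → [ a ≟ᶠ b ] ≡ 1ℚ
δ-≡ {a = a} refl with a ≟ a
... | yes _   = refl
... | no a≢a = ⊥-elim (a≢a refl)

δ-≢ : ∀ {m} {a b : Fin m} → ¬ a ≡ b → [ a ≟ᶠ b ] ≡ 0ℚ
δ-≢ {a = a} {b} a≢b with a ≟ b
... | yes a≡b = ⊥-elim (a≢b a≡b)
... | no _    = refl

δ-resp : ∀ {m k} {a b : Fin m} {c d : Fin k} →
  (a ≡ b → c ≡ d) → (c ≡ d → a ≡ b) → [ a ≟ᶠ b ] ≡ [ c ≟ᶠ d ]
δ-resp {a = a} {b} to from with a ≟ b
... | yes a≡b = sym (δ-≡ (to a≡b))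
... | no a≢b  = sym (δ-≢ (λ c≡d → a≢b (from c≡d)))

δ-sym : ∀ {m} (a b : Fin m) → [ a ≟ᶠ b ] ≡ [ b ≟ᶠ a ]
δ-sym a b = δ-resp {a = a} {b} sym sym

δ-*-cong : ∀ {m} (a b : Fin m) {x y} → (a ≡ b → x ≡ y) → [ a ≟ᶠ b ] * x ≡ [ a ≟ᶠ b ] * y
δ-*-cong a b {x} {y} x≡y with a ≟ b
... | yes a≡b = cong (1ℚ *_) (x≡y a≡b)
... | no _    = trans (*-zeroˡ x) (sym (*-zeroˡ y))

sumFin-δ : ∀ {m} (x : Fin m) (f : Fin m → ℚ) → sumFin (λ i → [ i ≟ᶠ x ] * f i) ≡ f x
sumFin-δ {suc m} zero f = begin
  [ zero {m} ≟ᶠ zero ] * f zero + sumFin (λ i → [ suc i ≟ᶠ zero ] * f (suc i))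
    ≡⟨ cong₂ _+_ (cong (_* f zero) (δ-≡ {a = zero {m}} refl))
                 (trans (sumFin-cong (λ i → trans (cong (_* f (suc i)) (δ-≢ {a = suc i} {zero} (λ ())))
                                                  (*-zeroˡ (f (suc i)))))
                        (sumFin-zero {m})) ⟩
  1ℚ * f zero + 0ℚ
    ≡⟨ trans (+-identityʳ _) (*-identityˡ _) ⟩
  f zero ∎
  where open ≡-Reasoning
sumFin-δ {suc m} (suc x) f = begin
  [ zero ≟ᶠ suc x ] * f zero + sumFin (λ i → [ suc i ≟ᶠ suc x ] * f (suc i))
    ≡⟨ cong₂ _+_ (trans (cong (_* f zero) (δ-≢ {a = zero} {suc x} (λ ()))) (*-zeroˡ (f zero)))
                 (sumFin-cong (λ i → cong (_* f (suc i))
                                          (δ-resp {a = suc i} {suc x} suc-injective (cong suc)))) ⟩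
  0ℚ + sumFin (λ i → [ i ≟ᶠ x ] * f (suc i))
    ≡⟨ trans (+-identityˡ _) (sumFin-δ x (λ i → f (suc i))) ⟩
  f (suc x) ∎
  where open ≡-Reasoning

sumIf-cong : ∀ b {f g : T b → ℚ} → (∀ p → f p ≡ g p) → sumIf b f ≡ sumIf b g
sumIf-cong true  f≗g = f≗g tt
sumIf-cong false f≗g = refl

sumIf-at : ∀ {b} (f : T b → ℚ) (p : T b) → sumIf b f ≡ f p
sumIf-at {true} f tt = refl

sumIf-+ : ∀ b (f g : T b → ℚ) → sumIf b (λ p → f p + g p) ≡ sumIf b f + sumIf b g
sumIf-+ true  f g = refl
sumIf-+ false f g = refl

sumIf-*ˡ : ∀ b c (f : T b → ℚ) → sumIf b (λ p → c * f p) ≡ c * sumIf b f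
sumIf-*ˡ true  c f = refl
sumIf-*ˡ false c f = sym (*-zeroʳ c)

sumIf-sumFin-comm : ∀ b {m} (f : T b → Fin m → ℚ) →
  sumIf b (λ p → sumFin (f p)) ≡ sumFin (λ j → sumIf b (λ p → f p j))
sumIf-sumFin-comm true  f = refl
sumIf-sumFin-comm false {m} f = sym (sumFin-zero {m})

sumIf-comm : ∀ b c (f : T b → T c → ℚ) →
  sumIf b (λ p → sumIf c (f p)) ≡ sumIf c (λ q → sumIf b (λ p → f p q))
sumIf-comm true  c     f = refl
sumIf-comm false true  f = refl
sumIf-comm false false f = refl

p≤p+q : ∀ p {q} → 0ℚ ≤ q → p ≤ p + q
p≤p+q p {q} 0≤q = subst (_≤ p + q) (+-identityʳ p) (+-monoʳ-≤ p 0≤q)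

p≤q⇒0≤q-p : ∀ {p q} → p ≤ q → 0ℚ ≤ q - p
p≤q⇒0≤q-p {p} {q} p≤q = subst (_≤ q - p) (+-inverseʳ p) (+-monoˡ-≤ (- p) p≤q)

0≤q-p⇒p≤q : ∀ {p q} → 0ℚ ≤ q - p → p ≤ q
0≤q-p⇒p≤q {p} {q} 0≤q-p =
  subst₂ _≤_ (+-identityˡ p) (solve 2 (λ p q → (q :- p) :+ p := q) refl p q) (+-monoˡ-≤ p 0≤q-p)

-‿antimonoʳ-≤ : ∀ r {p q} → p ≤ q → r - q ≤ r - p
-‿antimonoʳ-≤ r p≤q = +-monoʳ-≤ r (neg-antimono-≤ p≤q)

0≤* : ∀ {p q} → 0ℚ ≤ p → 0ℚ ≤ q → 0ℚ ≤ p * q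
0≤* {p} {q} 0≤p 0≤q =
  nonNegative⁻¹ _ {{nonNeg*nonNeg⇒nonNeg p {{nonNegative 0≤p}} q {{nonNegative 0≤q}}}}

*-mono-≤-nonNeg : ∀ {p q r s} → 0ℚ ≤ p → 0ℚ ≤ r → p ≤ q → r ≤ s → p * r ≤ q * s
*-mono-≤-nonNeg {p} {q} {r} {s} 0≤p 0≤r p≤q r≤s =
  ≤-trans (*-monoˡ-≤-nonNeg p {{nonNegative 0≤p}} r≤s)
          (*-monoʳ-≤-nonNeg s {{nonNegative (≤-trans 0≤r r≤s)}} p≤q)

δ-nonNeg : ∀ {m} (a b : Fin m) → 0ℚ ≤ [ a ≟ᶠ b ]
δ-nonNeg a b with a ≟ b
... | yes _ = nonNegative⁻¹ 1ℚ
... | no _  = ≤-refl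

1-δ-nonNeg : ∀ {m} (a b : Fin m) → 0ℚ ≤ 1ℚ - [ a ≟ᶠ b ]
1-δ-nonNeg a b with a ≟ b
... | yes _ = ≤-refl
... | no _  = nonNegative⁻¹ 1ℚ

sumFin-mono : ∀ {m} {f g : Fin m → ℚ} → (∀ i → f i ≤ g i) → sumFin f ≤ sumFin g
sumFin-mono {zero}  f≤g = ≤-refl
sumFin-mono {suc m} f≤g = +-mono-≤ (f≤g zero) (sumFin-mono (λ i → f≤g (suc i)))

sumFin-nonNeg : ∀ {m} {f : Fin m → ℚ} → (∀ i → 0ℚ ≤ f i) → 0ℚ ≤ sumFin f
sumFin-nonNeg {m} {f} 0≤f = subst (_≤ sumFin f) (sumFin-zero {m}) (sumFin-mono 0≤f)

sumFin-term : ∀ {m} {f : Fin m → ℚ} → (∀ i → 0ℚ ≤ f i) → ∀ x → f x ≤ sumFin f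
sumFin-term {suc m} {f} 0≤f zero = p≤p+q (f zero) (sumFin-nonNeg (λ i → 0≤f (suc i)))
sumFin-term {suc m} {f} 0≤f (suc x) =
  ≤-trans (sumFin-term (λ i → 0≤f (suc i)) x)
          (subst (sumFin (λ i → f (suc i)) ≤_) (+-comm _ (f zero)) (p≤p+q _ (0≤f zero)))

sumIf-mono : ∀ b {f g : T b → ℚ} → (∀ p → f p ≤ g p) → sumIf b f ≤ sumIf b g
sumIf-mono true  f≤g = f≤g tt
sumIf-mono false f≤g = ≤-refl

sumIf-nonNeg : ∀ b {f : T b → ℚ} → (∀ p → 0ℚ ≤ f p) → 0ℚ ≤ sumIf b f
sumIf-nonNeg true  0≤f = 0≤f tt
sumIf-nonNeg false 0≤f = ≤-refl

-- SeriesSum s L in Defs is Converges (partial s) L by definition.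
Converges : (ℕ → ℚ) → ℚ → Set
Converges a L = ∀ ε → 0ℚ < ε → ∃ λ N → ∀ K → N ℕ.≤ K → ∣ a K - L ∣ < ε

half-pos : ∀ {ε} → 0ℚ < ε → 0ℚ < ε * ½
half-pos 0<ε = *-monoˡ-<-pos ½ 0<ε

half+half : ∀ ε → ε * ½ + ε * ½ ≡ ε
half+half ε = trans (sym (*-distribˡ-+ ε ½ ½)) (*-identityʳ ε)

converges-cong : ∀ {a b L} → (∀ K → a K ≡ b K) → Converges a L → Converges b L
converges-cong {L = L} a≗b a→L ε 0<ε =
  let N , close = a→L ε 0<ε in
  N , λ K N≤K → subst (λ x → ∣ x - L ∣ < ε) (a≗b K) (close K N≤K)

converges-suc⁻ : ∀ {a L} → Converges (λ K → a (suc K)) L → Converges a L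
converges-suc⁻ a∘suc→L ε 0<ε =
  let N , close = a∘suc→L ε 0<ε in
  suc N , λ { (suc K) (ℕ.s≤s N≤K) → close K N≤K }

converges-const : ∀ c → Converges (λ _ → c) c
converges-const c ε 0<ε = 0 , λ K _ → subst (_< ε) (cong ∣_∣ (sym (+-inverseʳ c))) 0<ε

converges-+ : ∀ {a b L M} → Converges a L → Converges b M → Converges (λ K → a K + b K) (L + M)
converges-+ {a} {b} {L} {M} a→L b→M ε 0<ε =
  let N₁ , close₁ = a→L (ε * ½) (half-pos 0<ε)
      N₂ , close₂ = b→M (ε * ½) (half-pos 0<ε)
  in N₁ ℕ.⊔ N₂ , λ K N≤K → begin-strict
    ∣ (a K + b K) - (L + M) ∣ ≡⟨ cong ∣_∣ (regroup (a K) (b K) L M) ⟩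
    ∣ (a K - L) + (b K - M) ∣ ≤⟨ ∣p+q∣≤∣p∣+∣q∣ (a K - L) (b K - M) ⟩
    ∣ a K - L ∣ + ∣ b K - M ∣ <⟨ +-mono-< (close₁ K (ℕₚ.m⊔n≤o⇒m≤o N₁ N₂ N≤K))
                                          (close₂ K (ℕₚ.m⊔n≤o⇒n≤o N₁ N₂ N≤K)) ⟩
    ε * ½ + ε * ½             ≡⟨ half+half ε ⟩
    ε                         ∎
  where
  open ≤-Reasoning
  regroup : ∀ a b L M → (a + b) - (L + M) ≡ (a - L) + (b - M)
  regroup = solve 4 (λ a b L M → (a :+ b) :- (L :+ M) := (a :- L) :+ (b :- M)) refl

converges-*ˡ : ∀ c {a L} → Converges a L → Converges (λ K → c * a K) (c * L)
converges-*ˡ c {a} {L} a→L ε 0<ε =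
  let N , close = a→L (ε * 1/k) (positive⁻¹ _ {{pos*pos⇒pos ε {{positive 0<ε}} 1/k {{1/k-pos}}}})
  in N , λ K N≤K → begin-strict
    ∣ c * a K - c * L ∣
      ≡⟨ cong ∣_∣ (solve 3 (λ c a L → c :* a :- c :* L := c :* (a :- L)) refl c (a K) L) ⟩
    ∣ c * (a K - L) ∣
      ≡⟨ ∣p*q∣≡∣p∣*∣q∣ c (a K - L) ⟩
    ∣ c ∣ * ∣ a K - L ∣
      ≤⟨ *-monoʳ-≤-nonNeg ∣ a K - L ∣ {{∣-∣-nonNeg (a K - L)}} ∣c∣≤k ⟩
    k * ∣ a K - L ∣
      <⟨ *-monoʳ-<-pos k {{k-pos}} (close K N≤K) ⟩
    k * (ε * 1/k)
      ≡⟨ solve 3 (λ k ε i → k :* (ε :* i) := ε :* (k :* i)) refl k ε 1/k ⟩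
    ε * (k * 1/k)
      ≡⟨ trans (cong (ε *_) (*-inverseʳ k {{pos⇒nonZero k {{k-pos}}}})) (*-identityʳ ε) ⟩
    ε ∎
  where
  open ≤-Reasoning
  k : ℚ
  k = ∣ c ∣ + 1ℚ
  k-pos : Positive k
  k-pos = nonNeg+pos⇒pos ∣ c ∣ {{∣-∣-nonNeg c}} 1ℚ
  1/k : ℚ
  1/k = (1/ k) {{pos⇒nonZero k {{k-pos}}}}
  1/k-pos : Positive 1/k
  1/k-pos = 1/pos⇒pos k {{k-pos}}
  ∣c∣≤k : ∣ c ∣ ≤ k
  ∣c∣≤k = p≤p+q ∣ c ∣ (nonNegative⁻¹ 1ℚ)

≡-if-arbitrarilyClose : ∀ {L M} → (∀ ε → 0ℚ < ε → ∣ L - M ∣ < ε) → L ≡ M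
≡-if-arbitrarilyClose {L} {M} close with <-cmp 0ℚ ∣ L - M ∣
... | tri< 0<d _ _ = ⊥-elim (<-irrefl refl (close _ 0<d))
... | tri≈ _ 0≡d _ = x∙y⁻¹≈ε⇒x≈y L M (∣p∣≡0⇒p≡0 (L - M) (sym 0≡d))
... | tri> _ _ d<0 = ⊥-elim (<-irrefl refl (≤-<-trans (0≤∣p∣ (L - M)) d<0))

converges-unique : ∀ {a L M} → Converges a L → Converges a M → L ≡ M
converges-unique {a} {L} {M} a→L a→M = ≡-if-arbitrarilyClose λ ε 0<ε →
  let N₁ , close₁ = a→L (ε * ½) (half-pos 0<ε)
      N₂ , close₂ = a→M (ε * ½) (half-pos 0<ε)
      K = N₁ ℕ.⊔ N₂
  in begin-strict
    ∣ L - M ∣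
      ≡⟨ cong ∣_∣ (solve 3 (λ a L M → L :- M := (:- (a :- L)) :+ (a :- M)) refl (a K) L M) ⟩
    ∣ - (a K - L) + (a K - M) ∣
      ≤⟨ ∣p+q∣≤∣p∣+∣q∣ (- (a K - L)) (a K - M) ⟩
    ∣ - (a K - L) ∣ + ∣ a K - M ∣
      ≡⟨ cong (_+ ∣ a K - M ∣) (∣-p∣≡∣p∣ (a K - L)) ⟩
    ∣ a K - L ∣ + ∣ a K - M ∣
      <⟨ +-mono-< (close₁ K (ℕₚ.m≤m⊔n N₁ N₂)) (close₂ K (ℕₚ.m≤n⊔m N₁ N₂)) ⟩
    ε * ½ + ε * ½
      ≡⟨ half+half ε ⟩
    ε ∎
  where open ≤-Reasoning

converges-sumFin : ∀ {m} {a : Fin m → ℕ → ℚ} {L : Fin m → ℚ} →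
  (∀ i → Converges (a i) (L i)) → Converges (λ K → sumFin (λ i → a i K)) (sumFin L)
converges-sumFin {zero}  _   = converges-const 0ℚ
converges-sumFin {suc m} {a} a→L =
  converges-+ {a zero} {λ K → sumFin (λ i → a (suc i) K)}
    (a→L zero) (converges-sumFin {a = λ i → a (suc i)} (λ i → a→L (suc i)))

converges-sumIf : ∀ b {a : T b → ℕ → ℚ} {L : T b → ℚ} →
  (∀ p → Converges (a p) (L p)) → Converges (λ K → sumIf b (λ p → a p K)) (sumIf b L)
converges-sumIf true  a→L = a→L tt
converges-sumIf false _   = converges-const 0ℚ

ℕ→ℚ≡mkℚ : ∀ k → ℕ→ℚ k ≡ mkℚ (ℤ.+ k) 0 (Coprime.sym (1-coprimeTo k))
ℕ→ℚ≡mkℚ k = normalize-coprime (Coprime.sym (1-coprimeTo k))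

recip≡mkℚ : ∀ k → recip (suc k) ≡ mkℚ (ℤ.+ 1) k (1-coprimeTo (suc k))
recip≡mkℚ k = normalize-coprime (1-coprimeTo (suc k))

ℕ→ℚ-suc : ∀ k → ℕ→ℚ (suc k) ≡ ℕ→ℚ k + 1ℚ
ℕ→ℚ-suc zero    = refl
ℕ→ℚ-suc (suc k) = sym (trans (cong (_+ 1ℚ) (ℕ→ℚ≡mkℚ (suc k)))
  (cong (λ x → ℤ.+ x / 1) (trans (cong (ℕ._+ 1) (ℕₚ.*-identityʳ (suc k))) (ℕₚ.+-comm (suc k) 1))))

ℕ→ℚ-nonNeg : ∀ k → 0ℚ ≤ ℕ→ℚ k
ℕ→ℚ-nonNeg k = nonNegative⁻¹ _ {{normalize-nonNeg k 1}}

recip-inverseˡ : ∀ {k} → 1 ℕ.≤ k → recip k * ℕ→ℚ k ≡ 1ℚ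
recip-inverseˡ {suc k} _ = trans (cong₂ _*_ (recip≡mkℚ k) (ℕ→ℚ≡mkℚ (suc k)))
                         (*-inverseˡ (mkℚ (ℤ.+ suc k) 0 (Coprime.sym (1-coprimeTo (suc k)))))

recip-pred-inverseˡ : ∀ {k} → 2 ℕ.≤ k → recip (k ∸ 1) * (ℕ→ℚ k - 1ℚ) ≡ 1ℚ
recip-pred-inverseˡ {suc (suc k)} (ℕ.s≤s (ℕ.s≤s _)) = begin
  recip (suc k) * (ℕ→ℚ (suc (suc k)) - 1ℚ)
    ≡⟨ cong (λ z → recip (suc k) * (z - 1ℚ)) (ℕ→ℚ-suc (suc k)) ⟩
  recip (suc k) * (ℕ→ℚ (suc k) + 1ℚ - 1ℚ)
    ≡⟨ cong (recip (suc k) *_) (solve 1 (λ c → c :+ con 1ℚ :- con 1ℚ := c) refl (ℕ→ℚ (suc k))) ⟩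
  recip (suc k) * ℕ→ℚ (suc k)
    ≡⟨ recip-inverseˡ {suc k} (ℕ.s≤s ℕ.z≤n) ⟩
  1ℚ ∎
  where open ≡-Reasoning

recip-pos : ∀ k → 0ℚ < recip (suc k)
recip-pos k = positive⁻¹ _ {{normalize-pos 1 (suc k)}}

recip-pos-Fin : ∀ {k} → Fin k → 0ℚ < recip k
recip-pos-Fin {suc k} _ = recip-pos k

recip-nonNeg : ∀ k → 0ℚ ≤ recip k
recip-nonNeg zero    = ≤-refl
recip-nonNeg (suc k) = <⇒≤ (recip-pos k)

recip-antimono : ∀ {k m} → k ℕ.≤ m → recip (suc m) ≤ recip (suc k)
recip-antimono {k} {m} k≤m rewrite recip≡mkℚ k | recip≡mkℚ m =
  *≤* (subst₂ ℤ._≤_ (sym (ℤₚ.*-identityˡ (ℤ.+ suc k))) (sym (ℤₚ.*-identityˡ (ℤ.+ suc m)))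
                    (ℤ.+≤+ (ℕ.s≤s k≤m)))

recip≤1 : ∀ k → recip k ≤ 1ℚ
recip≤1 zero    = nonNegative⁻¹ 1ℚ
recip≤1 (suc k) = recip-antimono {0} {k} ℕ.z≤n

recip-pred-≥ : ∀ {d m} → 2 ℕ.≤ d → d ℕ.≤ m → recip m ≤ recip (d ∸ 1)
recip-pred-≥ {suc (suc k)} {suc m} (ℕ.s≤s (ℕ.s≤s _)) (ℕ.s≤s d≤m) =
  recip-antimono (ℕₚ.≤-trans (ℕₚ.n≤1+n k) d≤m)

archimedean : ∀ q → ∃ λ k → q < ℕ→ℚ k
archimedean (mkℚ (ℤ.+ a) d-1 c) = suc a ,
  subst (mkℚ (ℤ.+ a) d-1 c <_) (sym (ℕ→ℚ≡mkℚ (suc a)))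
    (*<* (subst₂ ℤ._<_ (sym (ℤₚ.*-identityʳ (ℤ.+ a))) (ℤₚ.pos-* (suc a) (suc d-1))
      (ℤ.+<+ (ℕ.s≤s (ℕₚ.≤-trans (ℕₚ.m≤m*n a (suc d-1)) (ℕₚ.m≤n+m _ d-1))))))
archimedean (mkℚ ℤ.-[1+ a ] d-1 _) = 0 , *<* ℤ.-<+

^-nonNeg : ∀ {x} → 0ℚ ≤ x → ∀ k → 0ℚ ≤ x ^ k
^-nonNeg 0≤x zero    = nonNegative⁻¹ 1ℚ
^-nonNeg 0≤x (suc k) = 0≤* 0≤x (^-nonNeg 0≤x k)

^-pos : ∀ {x} → 0ℚ < x → ∀ k → 0ℚ < x ^ k
^-pos 0<x zero    = positive⁻¹ 1ℚ
^-pos {x} 0<x (suc k) =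
  positive⁻¹ _ {{pos*pos⇒pos x {{positive 0<x}} (x ^ k) {{positive (^-pos 0<x k)}}}}

^≤1 : ∀ {x} → 0ℚ ≤ x → x ≤ 1ℚ → ∀ k → x ^ k ≤ 1ℚ
^≤1 0≤x x≤1 zero    = ≤-refl
^≤1 0≤x x≤1 (suc k) = *-mono-≤-nonNeg 0≤x (^-nonNeg 0≤x k) x≤1 (^≤1 0≤x x≤1 k)

^-antimonoʳ : ∀ {x} → 0ℚ ≤ x → x ≤ 1ℚ → ∀ {k m} → k ℕ.≤ m → x ^ m ≤ x ^ k
^-antimonoʳ 0≤x x≤1 {m = m} ℕ.z≤n = ^≤1 0≤x x≤1 m
^-antimonoʳ {x} 0≤x x≤1 (ℕ.s≤s k≤m) =
  *-monoˡ-≤-nonNeg x {{nonNegative 0≤x}} (^-antimonoʳ 0≤x x≤1 k≤m)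

bernoulli : ∀ {θ} → 0ℚ ≤ θ → θ ≤ 1ℚ → ∀ k → (1ℚ - θ) ^ k * (1ℚ + ℕ→ℚ k * θ) ≤ 1ℚ
bernoulli {θ} 0≤θ θ≤1 zero =
  ≤-reflexive (solve 1 (λ θ → con 1ℚ :* (con 1ℚ :+ con 0ℚ :* θ) := con 1ℚ) refl θ)
bernoulli {θ} 0≤θ θ≤1 (suc k) = begin
  (1ℚ - θ) * p * (1ℚ + ℕ→ℚ (suc k) * θ)
    ≡⟨ cong (λ z → (1ℚ - θ) * p * (1ℚ + z * θ)) (ℕ→ℚ-suc k) ⟩
  (1ℚ - θ) * p * (1ℚ + (ℕ→ℚ k + 1ℚ) * θ)
    ≡⟨ expand p (ℕ→ℚ k) θ ⟩
  p * ((1ℚ + ℕ→ℚ k * θ) - (ℕ→ℚ k + 1ℚ) * θ * θ)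
    ≤⟨ *-monoˡ-≤-nonNeg p {{nonNegative 0≤p}} drop-square ⟩
  p * (1ℚ + ℕ→ℚ k * θ)
    ≤⟨ bernoulli 0≤θ θ≤1 k ⟩
  1ℚ ∎
  where
  open ≤-Reasoning
  p : ℚ
  p = (1ℚ - θ) ^ k
  0≤p : 0ℚ ≤ p
  0≤p = ^-nonNeg (p≤q⇒0≤q-p θ≤1) k
  expand : ∀ p k θ → (1ℚ - θ) * p * (1ℚ + (k + 1ℚ) * θ) ≡ p * ((1ℚ + k * θ) - (k + 1ℚ) * θ * θ)
  expand = solve 3 (λ p k θ → (con 1ℚ :- θ) :* p :* (con 1ℚ :+ (k :+ con 1ℚ) :* θ)
                           := p :* ((con 1ℚ :+ k :* θ) :- (k :+ con 1ℚ) :* θ :* θ)) refl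
  drop-square : (1ℚ + ℕ→ℚ k * θ) - (ℕ→ℚ k + 1ℚ) * θ * θ ≤ 1ℚ + ℕ→ℚ k * θ
  drop-square = 0≤q-p⇒p≤q (subst (0ℚ ≤_)
    (solve 2 (λ a s → s := a :- (a :- s)) refl (1ℚ + ℕ→ℚ k * θ) ((ℕ→ℚ k + 1ℚ) * θ * θ))
    (0≤* (0≤* (subst (0ℚ ≤_) (ℕ→ℚ-suc k) (ℕ→ℚ-nonNeg (suc k))) 0≤θ) 0≤θ))

^-small : ∀ {θ} → 0ℚ < θ → θ ≤ 1ℚ → ∀ {ε} → 0ℚ < ε → ∃ λ k → (1ℚ - θ) ^ k < ε
^-small {θ} 0<θ θ≤1 {ε} 0<ε =
  let k , q<k = archimedean ((1/ (θ * ε)) {{pos⇒nonZero (θ * ε) {{θε-pos}}}}) in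
  k , *-cancelʳ-<-nonNeg (1ℚ + ℕ→ℚ k * θ) {{nonNegative (1+kθ-nonNeg k)}} (begin-strict
    (1ℚ - θ) ^ k * (1ℚ + ℕ→ℚ k * θ) ≤⟨ bernoulli (<⇒≤ 0<θ) θ≤1 k ⟩
    1ℚ                              <⟨ one<kθε k q<k ⟩
    ℕ→ℚ k * θ * ε                   ≤⟨ *-monoʳ-≤-nonNeg ε {{nonNegative (<⇒≤ 0<ε)}}
                                         (subst (_≤ 1ℚ + ℕ→ℚ k * θ) (+-identityˡ (ℕ→ℚ k * θ))
                                                (+-monoˡ-≤ (ℕ→ℚ k * θ) (nonNegative⁻¹ 1ℚ))) ⟩
    (1ℚ + ℕ→ℚ k * θ) * ε            ≡⟨ *-comm _ ε ⟩
    ε * (1ℚ + ℕ→ℚ k * θ)            ∎)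
  where
  open ≤-Reasoning
  θε-pos : Positive (θ * ε)
  θε-pos = pos*pos⇒pos θ {{positive 0<θ}} ε {{positive 0<ε}}
  1+kθ-nonNeg : ∀ k → 0ℚ ≤ 1ℚ + ℕ→ℚ k * θ
  1+kθ-nonNeg k = ≤-trans (nonNegative⁻¹ 1ℚ) (p≤p+q 1ℚ (0≤* (ℕ→ℚ-nonNeg k) (<⇒≤ 0<θ)))
  one<kθε : ∀ k → (1/ (θ * ε)) {{pos⇒nonZero (θ * ε) {{θε-pos}}}} < ℕ→ℚ k →
    1ℚ < ℕ→ℚ k * θ * ε
  one<kθε k q<k =
    subst₂ _<_ (*-inverseˡ (θ * ε) {{pos⇒nonZero (θ * ε) {{θε-pos}}}}) (sym (*-assoc (ℕ→ℚ k) θ ε))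
      (*-monoˡ-<-pos (θ * ε) {{θε-pos}} q<k)

Bounded : ∀ {A : Set} → (A → ℕ) → Set
Bounded {A} F = ∃ λ N → ∀ (x : A) → F x ℕ.≤ N

bounded-Fin : ∀ {k} (F : Fin k → ℕ) → Bounded F
bounded-Fin {zero}  F = 0 , λ ()
bounded-Fin {suc k} F =
  let N , F≤N = bounded-Fin (λ i → F (suc i)) in
  F zero ℕ.⊔ N , λ { zero → ℕₚ.m≤m⊔n (F zero) N
                   ; (suc i) → ℕₚ.≤-trans (F≤N i) (ℕₚ.m≤n⊔m (F zero) N) }

bounded-T : ∀ b (F : T b → ℕ) → Bounded F
bounded-T true  F = F tt , λ { tt → ℕₚ.≤-refl }
bounded-T false F = 0 , λ ()

bounded-Σ : ∀ {A : Set} {B : A → Set} →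
  (∀ (F : A → ℕ) → Bounded F) → (∀ a (F : B a → ℕ) → Bounded F) →
  ∀ (F : Σ A B → ℕ) → Bounded F
bounded-Σ bounded-A bounded-B F =
  let N , N-bound = bounded-A (λ a → proj₁ (bounded-B a (λ b → F (a , b)))) in
  N , λ (a , b) → ℕₚ.≤-trans (proj₂ (bounded-B a (λ b → F (a , b))) b) (N-bound a)

count : ∀ {k} → (Fin k → Bool) → ℕ
count {zero}  b = 0
count {suc k} b = (if b zero then 1 else 0) ℕ.+ count (λ x → b (suc x))

-- deg counts with a function local to its definition; the graph whose rows are
-- the shifted rows of G replays that recursion one vertex at a time.
deg≡count : ∀ {n} (G : Graph n) i → deg G i ≡ count (G i)
deg≡count {zero}        G i = refl
deg≡count {suc zero}    G i = refl
deg≡count {suc (suc n)} G i = cong ((if G i zero then 1 else 0) ℕ.+_) (deg≡count (λ _ y → G i (suc y)) zero)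

count≤ : ∀ {k} (b : Fin k → Bool) → count b ℕ.≤ k
count≤ {zero}  b = ℕ.z≤n
count≤ {suc k} b with b zero
... | true  = ℕ.s≤s (count≤ (λ x → b (suc x)))
... | false = ℕₚ.m≤n⇒m≤1+n (count≤ (λ x → b (suc x)))

count-ℚ : ∀ {k} (b : Fin k → Bool) → ℕ→ℚ (count b) ≡ sumFin (λ j → sumIf (b j) (λ _ → 1ℚ))
count-ℚ {zero}  b = refl
count-ℚ {suc k} b with b zero
... | true  =
  trans (ℕ→ℚ-suc c) (trans (+-comm (ℕ→ℚ c) 1ℚ) (cong (1ℚ +_) (count-ℚ (λ x → b (suc x)))))
  where
  c : ℕ
  c = count (λ x → b (suc x))
... | false =
  trans (count-ℚ (λ x → b (suc x))) (sym (+-identityˡ (sumFin (λ j → sumIf (b (suc j)) (λ _ → 1ℚ)))))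

witness⇒1≤count : ∀ {k} (b : Fin k → Bool) {w} → T (b w) → 1 ℕ.≤ count b
witness⇒1≤count {suc k} b {zero} bw with b zero
... | true = ℕ.s≤s ℕ.z≤n
witness⇒1≤count {suc k} b {suc w} bw with b zero
... | true  = ℕ.s≤s ℕ.z≤n
... | false = witness⇒1≤count (λ x → b (suc x)) bw

count-witness : ∀ {k} (b : Fin k → Bool) → 1 ℕ.≤ count b → ∃ λ w → T (b w)
count-witness {suc k} b 1≤c with b zero in b0
... | true  = zero , subst T (sym b0) tt
... | false = let w , bw = count-witness (λ x → b (suc x)) 1≤c in suc w , bw

count-witness-≢ : ∀ {k} (b : Fin k → Bool) → 2 ℕ.≤ count b → ∀ x → ∃ λ w → T (b w) × ¬ w ≡ x
count-witness-≢ {suc k} b 2≤c x with b zero in b0 | x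
... | true  | suc _ = zero , subst T (sym b0) tt , λ ()
... | true  | zero  = let w , bw = count-witness (λ y → b (suc y)) (ℕₚ.≤-pred 2≤c) in suc w , bw , λ ()
... | false | zero  = let w , bw = count-witness (λ y → b (suc y)) (ℕₚ.≤-trans (ℕ.s≤s ℕ.z≤n) 2≤c) in
                      suc w , bw , λ ()
... | false | suc x′ = let w , bw , w≢x′ = count-witness-≢ (λ y → b (suc y)) 2≤c x′ in
                       suc w , bw , λ sw≡sx′ → w≢x′ (suc-injective sw≡sx′)

module DirectedEdges {n : ℕ} (G : Graph n) where

  tl hd : DE G → Fin n
  tl = tail G
  hd = head G

  ∑ₑ : (DE G → ℚ) → ℚ
  ∑ₑ = sumDE G

  cell : (DE G → ℚ) → Fin n → Fin n → ℚ
  cell F i j = sumIf (G i j) (λ p → F ((i , j) , p))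

  row : (DE G → ℚ) → Fin n → ℚ
  row F i = sumFin (cell F i)

  private
    cell-nonNeg : ∀ {F : DE G → ℚ} → (∀ e → 0ℚ ≤ F e) → ∀ i j → 0ℚ ≤ cell F i j
    cell-nonNeg 0≤F i j = sumIf-nonNeg (G i j) λ p → 0≤F ((i , j) , p)

    row-nonNeg : ∀ {F : DE G → ℚ} → (∀ e → 0ℚ ≤ F e) → ∀ i → 0ℚ ≤ row F i
    row-nonNeg 0≤F i = sumFin-nonNeg (cell-nonNeg 0≤F i)

  ∑ₑ-cong : ∀ {F H : DE G → ℚ} → (∀ e → F e ≡ H e) → ∑ₑ F ≡ ∑ₑ H
  ∑ₑ-cong F≗H = sumFin-cong λ i → sumFin-cong λ j → sumIf-cong (G i j) λ p → F≗H ((i , j) , p)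

  ∑ₑ-+ : ∀ (F H : DE G → ℚ) → ∑ₑ (λ e → F e + H e) ≡ ∑ₑ F + ∑ₑ H
  ∑ₑ-+ F H = trans
    (sumFin-cong λ i → trans
      (sumFin-cong λ j → sumIf-+ (G i j) (λ p → F ((i , j) , p)) (λ p → H ((i , j) , p)))
      (sumFin-+ (cell F i) (cell H i)))
    (sumFin-+ (row F) (row H))

  ∑ₑ-*ˡ : ∀ c (F : DE G → ℚ) → ∑ₑ (λ e → c * F e) ≡ c * ∑ₑ F
  ∑ₑ-*ˡ c F = trans
    (sumFin-cong λ i → trans
      (sumFin-cong λ j → sumIf-*ˡ (G i j) c (λ p → F ((i , j) , p)))
      (sumFin-*ˡ c (cell F i)))
    (sumFin-*ˡ c (row F))

  ∑ₑ-*ʳ : ∀ c (F : DE G → ℚ) → ∑ₑ (λ e → F e * c) ≡ ∑ₑ F * c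
  ∑ₑ-*ʳ c F = trans (∑ₑ-cong (λ e → *-comm (F e) c)) (trans (∑ₑ-*ˡ c F) (*-comm c (∑ₑ F)))

  ∑ₑ-- : ∀ (F H : DE G → ℚ) → ∑ₑ (λ e → F e - H e) ≡ ∑ₑ F - ∑ₑ H
  ∑ₑ-- F H = begin
    ∑ₑ (λ e → F e - H e)           ≡⟨ ∑ₑ-cong (λ e → cong (F e +_) (neg-as-* (H e))) ⟩
    ∑ₑ (λ e → F e + - 1ℚ * H e)    ≡⟨ trans (∑ₑ-+ F _) (cong (∑ₑ F +_) (∑ₑ-*ˡ (- 1ℚ) H)) ⟩
    ∑ₑ F + - 1ℚ * ∑ₑ H             ≡⟨ cong (∑ₑ F +_) (sym (neg-as-* (∑ₑ H))) ⟩
    ∑ₑ F - ∑ₑ H                    ∎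
    where
    open ≡-Reasoning
    neg-as-* : ∀ x → - x ≡ - 1ℚ * x
    neg-as-* = solve 1 (λ x → :- x := :- con 1ℚ :* x) refl

  ∑ₑ-mono : ∀ {F H : DE G → ℚ} → (∀ e → F e ≤ H e) → ∑ₑ F ≤ ∑ₑ H
  ∑ₑ-mono F≤H = sumFin-mono λ i → sumFin-mono λ j → sumIf-mono (G i j) λ p → F≤H ((i , j) , p)

  ∑ₑ-nonNeg : ∀ {F : DE G → ℚ} → (∀ e → 0ℚ ≤ F e) → 0ℚ ≤ ∑ₑ F
  ∑ₑ-nonNeg 0≤F = sumFin-nonNeg λ i → row-nonNeg 0≤F i

  ∑ₑ-term : ∀ {F : DE G → ℚ} → (∀ e → 0ℚ ≤ F e) → ∀ e → F e ≤ ∑ₑ F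
  ∑ₑ-term {F} 0≤F ((i , j) , p) = begin
    F ((i , j) , p)                                     ≡⟨ sym (sumIf-at (λ p → F ((i , j) , p)) p) ⟩
    cell F i j                                          ≤⟨ sumFin-term (cell-nonNeg 0≤F i) j ⟩
    row F i                                             ≤⟨ sumFin-term (row-nonNeg 0≤F) i ⟩
    ∑ₑ F                                                ∎
    where open ≤-Reasoning

  ∑ₑ-sumFin-comm : ∀ {m} (F : DE G → Fin m → ℚ) →
    ∑ₑ (λ e → sumFin (F e)) ≡ sumFin (λ k → ∑ₑ (λ e → F e k))
  ∑ₑ-sumFin-comm F = trans
    (sumFin-cong λ i → trans
      (sumFin-cong λ j → sumIf-sumFin-comm (G i j) (λ p → F ((i , j) , p)))
      (sumFin-comm (λ j k → cell (λ e → F e k) i j)))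
    (sumFin-comm (λ i k → row (λ e → F e k) i))

  sumIf-∑ₑ-comm : ∀ b (F : T b → DE G → ℚ) →
    sumIf b (λ p → ∑ₑ (F p)) ≡ ∑ₑ (λ e → sumIf b (λ p → F p e))
  sumIf-∑ₑ-comm b F = trans
    (sumIf-sumFin-comm b (λ p → row (F p)))
    (sumFin-cong λ i → trans
      (sumIf-sumFin-comm b (λ p → cell (F p) i))
      (sumFin-cong λ j → sumIf-comm b (G i j) (λ p q → F p ((i , j) , q))))

  ∑ₑ-comm : ∀ (F : DE G → DE G → ℚ) →
    ∑ₑ (λ e → ∑ₑ (F e)) ≡ ∑ₑ (λ f → ∑ₑ (λ e → F e f))
  ∑ₑ-comm F = trans
    (sumFin-cong λ i → trans
      (sumFin-cong λ j → sumIf-∑ₑ-comm (G i j) (λ p → F ((i , j) , p)))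
      (sym (∑ₑ-sumFin-comm (λ f j → cell (λ e → F e f) i j))))
    (sym (∑ₑ-sumFin-comm (λ f i → row (λ e → F e f) i)))

  ∑ₑ-tail : ∀ a (F : DE G → ℚ) → ∑ₑ (λ g → [ tl g ≟ᶠ a ] * F g) ≡ row F a
  ∑ₑ-tail a F = trans
    (sumFin-cong λ i → trans
      (sumFin-cong λ j → sumIf-*ˡ (G i j) [ i ≟ᶠ a ] (λ p → F ((i , j) , p)))
      (sumFin-*ˡ [ i ≟ᶠ a ] (cell F i)))
    (sumFin-δ a (row F))

  ∑ₑ-at : ∀ e (F : DE G → ℚ) → ∑ₑ (λ g → [ tl g ≟ᶠ tl e ] * ([ hd g ≟ᶠ hd e ] * F g)) ≡ F e
  ∑ₑ-at e@((a , b) , pe) F = begin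
    ∑ₑ (λ g → [ tl g ≟ᶠ a ] * ([ hd g ≟ᶠ b ] * F g))
      ≡⟨ ∑ₑ-tail a (λ g → [ hd g ≟ᶠ b ] * F g) ⟩
    sumFin (λ j → sumIf (G a j) (λ p → [ j ≟ᶠ b ] * F ((a , j) , p)))
      ≡⟨ sumFin-cong (λ j → sumIf-*ˡ (G a j) [ j ≟ᶠ b ] _) ⟩
    sumFin (λ j → [ j ≟ᶠ b ] * cell F a j)
      ≡⟨ sumFin-δ b (cell F a) ⟩
    cell F a b
      ≡⟨ sumIf-at (λ p → F ((a , b) , p)) pe ⟩
    F e ∎
    where open ≡-Reasoning

  ∑ₑ-Iₑ : ∀ e (F : DE G → ℚ) → ∑ₑ (λ f → Iₑ G e f * F f) ≡ F e
  ∑ₑ-Iₑ e F = trans (∑ₑ-cong swap-δs) (∑ₑ-at e F)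
    where
    swap-δs : ∀ f → Iₑ G e f * F f ≡ [ tl f ≟ᶠ tl e ] * ([ hd f ≟ᶠ hd e ] * F f)
    swap-δs f = trans (cong₂ (λ a b → a * b * F f) (δ-sym (tl e) (tl f)) (δ-sym (hd e) (hd f)))
                      (*-assoc [ tl f ≟ᶠ tl e ] [ hd f ≟ᶠ hd e ] (F f))

  ∑ₑ-tail-const : ∀ a c → ∑ₑ (λ g → [ tl g ≟ᶠ a ] * c) ≡ ℕ→ℚ (deg G a) * c
  ∑ₑ-tail-const a c = begin
    ∑ₑ (λ g → [ tl g ≟ᶠ a ] * c)
      ≡⟨ ∑ₑ-tail a (λ _ → c) ⟩
    sumFin (λ j → sumIf (G a j) (λ _ → c))
      ≡⟨ sumFin-cong (λ j → trans (sumIf-cong (G a j) (λ _ → sym (*-identityʳ c)))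
                                  (sumIf-*ˡ (G a j) c (λ _ → 1ℚ))) ⟩
    sumFin (λ j → c * sumIf (G a j) (λ _ → 1ℚ))
      ≡⟨ sumFin-*ˡ c (λ j → sumIf (G a j) (λ _ → 1ℚ)) ⟩
    c * sumFin (λ j → sumIf (G a j) (λ _ → 1ℚ))
      ≡⟨ cong (c *_) (sym (trans (cong ℕ→ℚ (deg≡count G a)) (count-ℚ (G a)))) ⟩
    c * ℕ→ℚ (deg G a)
      ≡⟨ *-comm c _ ⟩
    ℕ→ℚ (deg G a) * c ∎
    where open ≡-Reasoning

  converges-∑ₑ : ∀ {a : DE G → ℕ → ℚ} {L : DE G → ℚ} →
    (∀ e → Converges (a e) (L e)) → Converges (λ K → ∑ₑ (λ e → a e K)) (∑ₑ L)
  converges-∑ₑ {a} a→L =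
    converges-sumFin {a = λ i K → row (λ e → a e K) i} λ i →
    converges-sumFin {a = λ j K → cell (λ e → a e K) i j} λ j →
    converges-sumIf (G i j) {a = λ p K → a ((i , j) , p) K} λ p → a→L ((i , j) , p)

  bounded-DE : ∀ (F : DE G → ℕ) → Bounded F
  bounded-DE = bounded-Σ (bounded-Σ bounded-Fin (λ _ → bounded-Fin)) (λ (i , j) → bounded-T (G i j))

  infixl 7 _∙ₑ_ _∙ᵥ_

  _∙ₑ_ : ∀ {A C : Set} → Mat A (DE G) → Mat (DE G) C → Mat A C
  _∙ₑ_ = _·ₑ_ G

  _∙ᵥ_ : ∀ {A C : Set} → Mat A (Fin n) → Mat (Fin n) C → Mat A C
  _∙ᵥ_ = _·ᵥ_ G

  ∙ₑ-assoc : ∀ {A C : Set} (X : Mat A (DE G)) (Y : Mat (DE G) (DE G)) (Z : Mat (DE G) C) →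
    ∀ a c → (X ∙ₑ Y ∙ₑ Z) a c ≡ (X ∙ₑ (Y ∙ₑ Z)) a c
  ∙ₑ-assoc X Y Z a c = begin
    ∑ₑ (λ f → ∑ₑ (λ g → X a g * Y g f) * Z f c)
      ≡⟨ ∑ₑ-cong (λ f → trans (sym (∑ₑ-*ʳ (Z f c) _))
                              (∑ₑ-cong (λ g → *-assoc (X a g) (Y g f) (Z f c)))) ⟩
    ∑ₑ (λ f → ∑ₑ (λ g → X a g * (Y g f * Z f c)))
      ≡⟨ ∑ₑ-comm (λ f g → X a g * (Y g f * Z f c)) ⟩
    ∑ₑ (λ g → ∑ₑ (λ f → X a g * (Y g f * Z f c)))
      ≡⟨ ∑ₑ-cong (λ g → ∑ₑ-*ˡ (X a g) _) ⟩
    ∑ₑ (λ g → X a g * ∑ₑ (λ f → Y g f * Z f c)) ∎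
    where open ≡-Reasoning

  ∙ₑ-∙ᵥ-assoc : ∀ {A C : Set} (X : Mat A (DE G)) (Y : Mat (DE G) (Fin n)) (Z : Mat (Fin n) C) →
    ∀ a c → (X ∙ₑ Y ∙ᵥ Z) a c ≡ (X ∙ₑ (Y ∙ᵥ Z)) a c
  ∙ₑ-∙ᵥ-assoc X Y Z a c = begin
    sumFin (λ k → ∑ₑ (λ g → X a g * Y g k) * Z k c)
      ≡⟨ sumFin-cong (λ k → trans (sym (∑ₑ-*ʳ (Z k c) _))
                                  (∑ₑ-cong (λ g → *-assoc (X a g) (Y g k) (Z k c)))) ⟩
    sumFin (λ k → ∑ₑ (λ g → X a g * (Y g k * Z k c)))
      ≡⟨ sym (∑ₑ-sumFin-comm (λ g k → X a g * (Y g k * Z k c))) ⟩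
    ∑ₑ (λ g → sumFin (λ k → X a g * (Y g k * Z k c)))
      ≡⟨ ∑ₑ-cong (λ g → sumFin-*ˡ (X a g) (λ k → Y g k * Z k c)) ⟩
    ∑ₑ (λ g → X a g * sumFin (λ k → Y g k * Z k c)) ∎
    where open ≡-Reasoning

  ∙ₑ-congˡ : ∀ {A C : Set} {X X′ : Mat A (DE G)} (Y : Mat (DE G) C) →
    ∀ a → (∀ g → X a g ≡ X′ a g) → ∀ c → (X ∙ₑ Y) a c ≡ (X′ ∙ₑ Y) a c
  ∙ₑ-congˡ Y a X≗X′ c = ∑ₑ-cong (λ g → cong (_* Y g c) (X≗X′ g))

  ∙ₑ-congʳ : ∀ {A C : Set} (X : Mat A (DE G)) {Y Y′ : Mat (DE G) C} →
    ∀ c → (∀ g → Y g c ≡ Y′ g c) → ∀ a → (X ∙ₑ Y) a c ≡ (X ∙ₑ Y′) a c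
  ∙ₑ-congʳ X c Y≗Y′ a = ∑ₑ-cong (λ g → cong (X a g *_) (Y≗Y′ g))

  Dinv∙Tm : ∀ w g → (Dinv G ∙ᵥ Tm G) w g ≡ recip (deg G w) * [ tl g ≟ᶠ w ]
  Dinv∙Tm w g = begin
    sumFin (λ k → [ w ≟ᶠ k ] * recip (deg G w) * [ tl g ≟ᶠ k ])
      ≡⟨ sumFin-cong reorder ⟩
    sumFin (λ k → [ k ≟ᶠ w ] * (recip (deg G w) * [ tl g ≟ᶠ k ]))
      ≡⟨ sumFin-δ w _ ⟩
    recip (deg G w) * [ tl g ≟ᶠ w ] ∎
    where
    open ≡-Reasoning
    reorder : ∀ k → [ w ≟ᶠ k ] * recip (deg G w) * [ tl g ≟ᶠ k ] ≡ [ k ≟ᶠ w ] * (recip (deg G w) * [ tl g ≟ᶠ k ])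
    reorder k = trans (cong (λ z → z * recip (deg G w) * [ tl g ≟ᶠ k ]) (δ-sym w k))
                      (*-assoc [ k ≟ᶠ w ] (recip (deg G w)) [ tl g ≟ᶠ k ])

  Tmᵀ∙Dinv∙Tm : ∀ h g → (Tmᵀ G ∙ᵥ (Dinv G ∙ᵥ Tm G)) h g ≡ recip (deg G (tl h)) * [ tl g ≟ᶠ tl h ]
  Tmᵀ∙Dinv∙Tm h g = begin
    sumFin (λ w → [ tl h ≟ᶠ w ] * (Dinv G ∙ᵥ Tm G) w g)
      ≡⟨ sumFin-cong (λ w → cong (_* (Dinv G ∙ᵥ Tm G) w g) (δ-sym (tl h) w)) ⟩
    sumFin (λ w → [ w ≟ᶠ tl h ] * (Dinv G ∙ᵥ Tm G) w g)
      ≡⟨ sumFin-δ (tl h) _ ⟩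
    (Dinv G ∙ᵥ Tm G) (tl h) g
      ≡⟨ Dinv∙Tm (tl h) g ⟩
    recip (deg G (tl h)) * [ tl g ≟ᶠ tl h ] ∎
    where open ≡-Reasoning

  ConstantOnTails : ∀ {C : Set} → Mat (DE G) C → Set
  ConstantOnTails Y = ∀ e e′ c → tl e ≡ tl e′ → Y e c ≡ Y e′ c

  tailAveraging-fixes : ∀ {C : Set} (Y : Mat (DE G) C) → ConstantOnTails Y →
    ∀ h c → (Tmᵀ G ∙ᵥ (Dinv G ∙ᵥ Tm G) ∙ₑ Y) h c ≡ Y h c
  tailAveraging-fixes Y const h@((a , b) , ab) c = begin
    ∑ₑ (λ g → (Tmᵀ G ∙ᵥ (Dinv G ∙ᵥ Tm G)) h g * Y g c)
      ≡⟨ ∑ₑ-cong weight ⟩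
    ∑ₑ (λ g → r * ([ tl g ≟ᶠ a ] * Y h c))
      ≡⟨ trans (∑ₑ-*ˡ r _) (cong (r *_) (∑ₑ-tail-const a (Y h c))) ⟩
    r * (ℕ→ℚ (deg G a) * Y h c)
      ≡⟨ sym (*-assoc r _ _) ⟩
    r * ℕ→ℚ (deg G a) * Y h c
      ≡⟨ cong (_* Y h c) (recip-inverseˡ 1≤deg) ⟩
    1ℚ * Y h c
      ≡⟨ *-identityˡ (Y h c) ⟩
    Y h c ∎
    where
    open ≡-Reasoning
    r : ℚ
    r = recip (deg G a)
    1≤deg : 1 ℕ.≤ deg G a
    1≤deg = subst (1 ℕ.≤_) (sym (deg≡count G a)) (witness⇒1≤count (G a) ab)
    weight : ∀ g → (Tmᵀ G ∙ᵥ (Dinv G ∙ᵥ Tm G)) h g * Y g c ≡ r * ([ tl g ≟ᶠ a ] * Y h c)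
    weight g = trans (cong (_* Y g c) (Tmᵀ∙Dinv∙Tm h g))
              (trans (*-assoc r _ (Y g c))
                     (cong (r *_) (δ-*-cong (tl g) a (λ ga → const g h c ga))))

length : ∀ {A : Set} {R : A → A → Set} {x y} → Star R x y → ℕ
length Star.ε    = 0
length (_ ◅ xs) = suc (length xs)

module NonBacktrackingWalk {n : ℕ} (G : Graph n) (symmetric : ∀ i j → G i j ≡ G j i)
                           (minDeg : MinDegTwo G) (connected : Connected G) where

  open DirectedEdges G

  P : Mat (DE G) (DE G)
  P = Pnb G

  P-nonNeg : ∀ f g → 0ℚ ≤ P f g
  P-nonNeg f g =
    0≤* (0≤* (δ-nonNeg (hd f) (tl g)) (1-δ-nonNeg (hd g) (tl f))) (recip-nonNeg (deg G (hd f) ∸ 1))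

  reverseEdge : DE G → DE G
  reverseEdge ((x , y) , xy) = (y , x) , subst T (symmetric x y) xy

  P-stochastic : ∀ f → ∑ₑ (P f) ≡ 1ℚ
  P-stochastic f@((x , y) , _) = begin
    ∑ₑ (P f)
      ≡⟨ ∑ₑ-cong (λ g → expand [ y ≟ᶠ tl g ] [ tl g ≟ᶠ y ] (δ-sym y (tl g)) [ hd g ≟ᶠ x ] r) ⟩
    ∑ₑ (λ g → r * ([ tl g ≟ᶠ y ] * 1ℚ - [ tl g ≟ᶠ y ] * ([ hd g ≟ᶠ x ] * 1ℚ)))
      ≡⟨ trans (∑ₑ-*ˡ r _) (cong (r *_) (∑ₑ-- _ _)) ⟩
    r * (∑ₑ (λ g → [ tl g ≟ᶠ y ] * 1ℚ) - ∑ₑ (λ g → [ tl g ≟ᶠ y ] * ([ hd g ≟ᶠ x ] * 1ℚ)))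
      ≡⟨ cong₂ (λ a b → r * (a - b)) (∑ₑ-tail-const y 1ℚ) (∑ₑ-at (reverseEdge f) (λ _ → 1ℚ)) ⟩
    r * (ℕ→ℚ (deg G y) * 1ℚ - 1ℚ)
      ≡⟨ cong (λ d → r * (d - 1ℚ)) (*-identityʳ (ℕ→ℚ (deg G y))) ⟩
    r * (ℕ→ℚ (deg G y) - 1ℚ)
      ≡⟨ recip-pred-inverseˡ (minDeg y) ⟩
    1ℚ ∎
    where
    open ≡-Reasoning
    r : ℚ
    r = recip (deg G y ∸ 1)
    expand : ∀ a a′ → a ≡ a′ → ∀ b r → a * (1ℚ - b) * r ≡ r * (a′ * 1ℚ - a′ * (b * 1ℚ))
    expand a .a refl =
      solve 3 (λ a b r → a :* (con 1ℚ :- b) :* r := r :* (a :* con 1ℚ :- a :* (b :* con 1ℚ))) refl a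

  Step : DE G → DE G → Set
  Step f g = hd f ≡ tl g × ¬ hd g ≡ tl f

  η : ℚ
  η = recip n

  η≤P : ∀ f g → Step f g → η ≤ P f g
  η≤P f@((x , y) , _) g (f→g , nb) = begin
    recip n
      ≤⟨ recip-pred-≥ (minDeg y) (deg≤n y) ⟩
    recip (deg G y ∸ 1)
      ≡⟨ sym (*-identityˡ _) ⟩
    1ℚ * recip (deg G y ∸ 1)
      ≡⟨ cong₂ (λ a b → a * (1ℚ - b) * recip (deg G y ∸ 1)) (sym (δ-≡ f→g)) (sym (δ-≢ nb)) ⟩
    P f g ∎
    where
    open ≤-Reasoning
    deg≤n : ∀ a → deg G a ℕ.≤ n
    deg≤n a = subst (ℕ._≤ n) (sym (deg≡count G a)) (count≤ (G a))

  Step-reverse : ∀ f g → Step f g → Step (reverseEdge g) (reverseEdge f)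
  Step-reverse f g (f→g , nb) = sym f→g , λ tf≡hg → nb (sym tf≡hg)

  reverse-path : ∀ {f g} → Star Step f g → Star Step (reverseEdge g) (reverseEdge f)
  reverse-path Star.ε = Star.ε
  reverse-path {f} (_◅_ {j = g₁} s p) = reverse-path p ◅◅ (Step-reverse f g₁ s ◅ Star.ε)

  next : ∀ f → ∃ (Step f)
  next ((x , y) , _) =
    let w , yw , w≢x = count-witness-≢ (G y) (subst (2 ℕ.≤_) (deg≡count G y) (minDeg y)) x in
    ((y , w) , yw) , refl , w≢x

  walk : DE G → ℕ → DE G
  walk f zero    = f
  walk f (suc k) = walk (proj₁ (next f)) k

  walk-step : ∀ f k → Step (walk f k) (walk f (suc k))
  walk-step f zero    = proj₂ (next f)
  walk-step f (suc k) = walk-step (proj₁ (next f)) k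

  walk-path : ∀ f k → Star Step f (walk f k)
  walk-path f zero    = Star.ε
  walk-path f (suc k) = proj₂ (next f) ◅ walk-path (proj₁ (next f)) k

  Enters : DE G → Fin n → Set
  Enters f y = ∃ λ g → Star Step f g × hd g ≡ y

  ReturnsToHead : DE G → Set
  ReturnsToHead f = ∃₂ λ g₁ g → Step f g₁ × Star Step g₁ g × hd g ≡ hd f

  -- Step both times back while the heads still agree
  -- one step earlier; then either c = 0, or the walk can turn around at time d and retrace itself
  -- back to the head of f.
  returnsToHead-from : ∀ f c d → c ℕ.< d → hd (walk f c) ≡ hd (walk f d) → ReturnsToHead f
  returnsToHead-from f zero (suc d) _ same = proj₁ (next f) , walk f (suc d) , proj₂ (next f) ,
    walk-path (proj₁ (next f)) d , sym same
  returnsToHead-from f (suc c) (suc d) (ℕ.s≤s c<d) same with hd (walk f c) ≟ hd (walk f d)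
  ... | yes same′ = returnsToHead-from f c d c<d same′
  ... | no differ = proj₁ (next f) , reverseEdge f₁ , proj₂ (next f) ,
    walk-path f₁ d ◅◅ (turn ◅ reverse-path (walk-path f₁ c)) , refl
    where
    f₁ : DE G
    f₁ = proj₁ (next f)
    turn : Step (walk f (suc d)) (reverseEdge (walk f (suc c)))
    turn = sym same , λ e → differ (trans (proj₁ (walk-step f c)) (trans e (sym (proj₁ (walk-step f d)))))

  returnsToHead : ∀ f → ReturnsToHead f
  returnsToHead f =
    let i , j , i<j , same = pigeonhole (ℕₚ.n<1+n n) (λ k → hd (walk f (toℕ k))) in
    returnsToHead-from f (toℕ i) (toℕ j) i<j same

  tail-entered : ∀ {f g} → Star Step f g → tl g ≡ tl f ⊎ Enters f (tl g)
  tail-entered Star.ε = inj₁ refl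
  tail-entered {f} (s ◅ p) with tail-entered p
  ... | inj₁ same          = inj₂ (f , Star.ε , trans (proj₁ s) (sym same))
  ... | inj₂ (g′ , p′ , e) = inj₂ (g′ , s ◅ p′ , e)

  tail-entered⁺ : ∀ {f g₁ g} → Step f g₁ → Star Step g₁ g → Enters f (tl g)
  tail-entered⁺ {f} s p with tail-entered p
  ... | inj₁ same          = f , Star.ε , trans (proj₁ s) (sym same)
  ... | inj₂ (g′ , p′ , e) = g′ , s ◅ p′ , e

  enters-tail : ∀ f → Enters f (tl f)
  enters-tail f with returnsToHead f
  ... | g₁ , g , s , p , g-head with tl g ≟ tl f
  ...   | yes same = subst (Enters f) same (tail-entered⁺ s p)
  ...   | no differ = reverseEdge f , (s ◅ p) ◅◅ ((g-head , λ e → differ (sym e)) ◅ Star.ε) , refl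

  enters-neighbour : ∀ {f y w} → Enters f y → T (G y w) → Enters f w
  enters-neighbour {f} {y} {w} (g , p , g-head) yw with w ≟ tl g
  ... | no fresh = ((y , w) , yw) , p ◅◅ ((g-head , fresh) ◅ Star.ε) , refl
  ... | yes back with tail-entered p
  ...   | inj₁ same = subst (Enters f) (sym (trans back same)) (enters-tail f)
  ...   | inj₂ entered = subst (Enters f) (sym back) entered

  enters-reachable : ∀ {f y v} → Reach G y v → Enters f y → Enters f v
  enters-reachable here         entered = entered
  enters-reachable (step yw r) entered = enters-reachable r (enters-neighbour entered yw)

  leaves-every-vertex : ∀ f v → ∃ λ g → Star Step f g × tl g ≡ v
  leaves-every-vertex f v =
    let g , p , g-head = enters-reachable (connected (hd f) v) (f , Star.ε , refl)
        g₁ , s = next g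
    in g₁ , p ◅◅ (s ◅ Star.ε) , trans (sym (proj₁ s)) g-head

  P⟨_⟩ : (DE G → ℚ) → DE G → ℚ
  P⟨ F ⟩ e = ∑ₑ (λ f → P e f * F f)

  P⟨⟩-cong : ∀ {F H} → (∀ f → F f ≡ H f) → ∀ e → P⟨ F ⟩ e ≡ P⟨ H ⟩ e
  P⟨⟩-cong F≗H e = ∑ₑ-cong (λ f → cong (P e f *_) (F≗H f))

  P⟨⟩-+ : ∀ F H e → P⟨ (λ f → F f + H f) ⟩ e ≡ P⟨ F ⟩ e + P⟨ H ⟩ e
  P⟨⟩-+ F H e = trans (∑ₑ-cong (λ f → *-distribˡ-+ (P e f) (F f) (H f))) (∑ₑ-+ _ _)

  P⟨⟩-*ˡ : ∀ c F e → P⟨ (λ f → c * F f) ⟩ e ≡ c * P⟨ F ⟩ e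
  P⟨⟩-*ˡ c F e = trans (∑ₑ-cong (λ f → *-left-commute (P e f) c (F f))) (∑ₑ-*ˡ c _)
    where
    *-left-commute : ∀ p c x → p * (c * x) ≡ c * (p * x)
    *-left-commute = solve 3 (λ p c x → p :* (c :* x) := c :* (p :* x)) refl

  P⟨⟩-const : ∀ c e → P⟨ (λ _ → c) ⟩ e ≡ c
  P⟨⟩-const c e = trans (∑ₑ-*ʳ c (P e)) (trans (cong (_* c) (P-stochastic e)) (*-identityˡ c))

  P⟨⟩-complement : ∀ F e → P⟨ (λ f → 1ℚ - F f) ⟩ e ≡ 1ℚ - P⟨ F ⟩ e
  P⟨⟩-complement F e = begin
    P⟨ (λ f → 1ℚ - F f) ⟩ e                 ≡⟨ ∑ₑ-cong (λ f → *-distribˡ-- (P e f) 1ℚ (F f)) ⟩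
    ∑ₑ (λ f → P e f * 1ℚ - P e f * F f)     ≡⟨ ∑ₑ-- (λ f → P e f * 1ℚ) (λ f → P e f * F f) ⟩
    P⟨ (λ _ → 1ℚ) ⟩ e - P⟨ F ⟩ e            ≡⟨ cong (_- P⟨ F ⟩ e) (P⟨⟩-const 1ℚ e) ⟩
    1ℚ - P⟨ F ⟩ e                           ∎
    where
    open ≡-Reasoning
    *-distribˡ-- : ∀ p x y → p * (x - y) ≡ p * x - p * y
    *-distribˡ-- = solve 3 (λ p x y → p :* (x :- y) := p :* x :- p :* y) refl

  P⟨⟩-mono : ∀ {F H} → (∀ f → F f ≤ H f) → ∀ e → P⟨ F ⟩ e ≤ P⟨ H ⟩ e
  P⟨⟩-mono F≤H e = ∑ₑ-mono (λ f → *-monoˡ-≤-nonNeg (P e f) {{nonNegative (P-nonNeg e f)}} (F≤H f))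

  P⟨⟩-nonNeg : ∀ {F} → (∀ f → 0ℚ ≤ F f) → ∀ e → 0ℚ ≤ P⟨ F ⟩ e
  P⟨⟩-nonNeg 0≤F e = ∑ₑ-nonNeg (λ f → 0≤* (P-nonNeg e f) (0≤F f))

  P⟨⟩-term : ∀ {F} → (∀ f → 0ℚ ≤ F f) → ∀ e g → P e g * F g ≤ P⟨ F ⟩ e
  P⟨⟩-term 0≤F e = ∑ₑ-term (λ f → 0≤* (P-nonNeg e f) (0≤F f))

  at : Fin n → DE G → ℚ
  at v e = [ tl e ≟ᶠ v ]

  hitWithin : Fin n → ℕ → DE G → ℚ
  hitWithin v K e = partial (λ k → hitProb G v k e) K

  survival : Fin n → ℕ → DE G → ℚ
  survival v K e = 1ℚ - hitWithin v K e

  hitProb-nonNeg : ∀ v k e → 0ℚ ≤ hitProb G v k e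
  hitProb-nonNeg v zero    e = δ-nonNeg (tl e) v
  hitProb-nonNeg v (suc k) e = 0≤* (1-δ-nonNeg (tl e) v) (P⟨⟩-nonNeg (hitProb-nonNeg v k) e)

  hitWithin-nonNeg : ∀ v K e → 0ℚ ≤ hitWithin v K e
  hitWithin-nonNeg v zero    e = hitProb-nonNeg v 0 e
  hitWithin-nonNeg v (suc K) e =
    ≤-trans (hitWithin-nonNeg v K e) (p≤p+q (hitWithin v K e) (hitProb-nonNeg v (suc K) e))

  hitWithin-suc : ∀ v K e → hitWithin v (suc K) e ≡ at v e + (1ℚ - at v e) * P⟨ hitWithin v K ⟩ e
  hitWithin-suc v zero    e = refl
  hitWithin-suc v (suc K) e = begin
    hitWithin v (suc K) e + (1ℚ - c) * P⟨ h ⟩ e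
      ≡⟨ cong (_+ (1ℚ - c) * P⟨ h ⟩ e) (hitWithin-suc v K e) ⟩
    c + (1ℚ - c) * P⟨ hitWithin v K ⟩ e + (1ℚ - c) * P⟨ h ⟩ e
      ≡⟨ solve 3 (λ c x y → c :+ (con 1ℚ :- c) :* x :+ (con 1ℚ :- c) :* y
                         := c :+ (con 1ℚ :- c) :* (x :+ y)) refl c (P⟨ hitWithin v K ⟩ e) (P⟨ h ⟩ e) ⟩
    c + (1ℚ - c) * (P⟨ hitWithin v K ⟩ e + P⟨ h ⟩ e)
      ≡⟨ cong (λ z → c + (1ℚ - c) * z) (sym (P⟨⟩-+ (hitWithin v K) h e)) ⟩
    c + (1ℚ - c) * P⟨ hitWithin v (suc K) ⟩ e ∎
    where
    open ≡-Reasoning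
    c : ℚ
    c = at v e
    h : DE G → ℚ
    h = hitProb G v (suc K)

  hitWithin-here : ∀ {v} e → tl e ≡ v → ∀ K → hitWithin v K e ≡ 1ℚ
  hitWithin-here e e-at-v zero    = δ-≡ e-at-v
  hitWithin-here {v} e e-at-v (suc K) = begin
    hitWithin v (suc K) e                     ≡⟨ hitWithin-suc v K e ⟩
    at v e + (1ℚ - at v e) * X                ≡⟨ cong (λ c → c + (1ℚ - c) * X) (δ-≡ e-at-v) ⟩
    1ℚ + (1ℚ - 1ℚ) * X                        ≡⟨ solve 1 (λ x → con 1ℚ :+ (con 1ℚ :- con 1ℚ) :* x := con 1ℚ) refl X ⟩
    1ℚ                                        ∎
    where
    open ≡-Reasoning
    X : ℚ
    X = P⟨ hitWithin v K ⟩ e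

  hitWithin-away : ∀ {v} e → ¬ tl e ≡ v → ∀ K → hitWithin v (suc K) e ≡ P⟨ hitWithin v K ⟩ e
  hitWithin-away {v} e e-away K = begin
    hitWithin v (suc K) e                     ≡⟨ hitWithin-suc v K e ⟩
    at v e + (1ℚ - at v e) * X                ≡⟨ cong (λ c → c + (1ℚ - c) * X) (δ-≢ e-away) ⟩
    0ℚ + (1ℚ - 0ℚ) * X                        ≡⟨ solve 1 (λ x → con 0ℚ :+ (con 1ℚ :- con 0ℚ) :* x := x) refl X ⟩
    X                                         ∎
    where
    open ≡-Reasoning
    X : ℚ
    X = P⟨ hitWithin v K ⟩ e

  survival-suc : ∀ v K e → survival v (suc K) e ≡ (1ℚ - at v e) * P⟨ survival v K ⟩ e
  survival-suc v K e = begin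
    1ℚ - hitWithin v (suc K) e       ≡⟨ cong (λ z → 1ℚ - z) (hitWithin-suc v K e) ⟩
    1ℚ - (c + (1ℚ - c) * X)          ≡⟨ solve 2 (λ c x → con 1ℚ :- (c :+ (con 1ℚ :- c) :* x)
                                                    := (con 1ℚ :- c) :* (con 1ℚ :- x)) refl c X ⟩
    (1ℚ - c) * (1ℚ - X)              ≡⟨ cong ((1ℚ - c) *_) (sym (P⟨⟩-complement (hitWithin v K) e)) ⟩
    (1ℚ - c) * P⟨ survival v K ⟩ e   ∎
    where
    open ≡-Reasoning
    c X : ℚ
    c = at v e
    X = P⟨ hitWithin v K ⟩ e

  survival-nonNeg : ∀ v K e → 0ℚ ≤ survival v K e
  survival-nonNeg v zero    e = 1-δ-nonNeg (tl e) v
  survival-nonNeg v (suc K) e = subst (0ℚ ≤_) (sym (survival-suc v K e))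
    (0≤* (1-δ-nonNeg (tl e) v) (P⟨⟩-nonNeg (survival-nonNeg v K) e))

  survival-antimono : ∀ v {K L} → K ℕ.≤ L → ∀ e → survival v L e ≤ survival v K e
  survival-antimono v {K} {L} K≤L e with ℕₚ.≤⇒≤′ K≤L
  ... | ℕ.≤′-refl            = ≤-refl
  ... | ℕ.≤′-step {L′} K≤′L′ =
    ≤-trans (-‿antimonoʳ-≤ 1ℚ (p≤p+q (hitWithin v L′ e) (hitProb-nonNeg v (suc L′) e)))
            (survival-antimono v (ℕₚ.≤′⇒≤ K≤′L′) e)

  0≤η : 0ℚ ≤ η
  0≤η = recip-nonNeg n

  η≤1 : η ≤ 1ℚ
  η≤1 = recip≤1 n

  hitWithin-along : ∀ {v f g} (p : Star Step f g) → tl g ≡ v → η ^ length p ≤ hitWithin v (length p) f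
  hitWithin-along {f = f} Star.ε f-at-v = ≤-reflexive (sym (hitWithin-here f f-at-v 0))
  hitWithin-along {v} {f} (_◅_ {j = g₁} s p) g-at-v = by-cases (tl f ≟ v)
    where
    open ≤-Reasoning
    L : ℕ
    L = length p
    by-cases : Dec (tl f ≡ v) → η ^ suc L ≤ hitWithin v (suc L) f
    by-cases (yes f-at-v) = subst (η ^ suc L ≤_) (sym (hitWithin-here f f-at-v (suc L))) (^≤1 0≤η η≤1 (suc L))
    by-cases (no f-away) = begin
      η * η ^ L                  ≤⟨ *-mono-≤-nonNeg 0≤η (^-nonNeg 0≤η L) (η≤P f g₁ s) (hitWithin-along p g-at-v) ⟩
      P f g₁ * hitWithin v L g₁  ≤⟨ P⟨⟩-term (hitWithin-nonNeg v L) f g₁ ⟩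
      P⟨ hitWithin v L ⟩ f       ≡⟨ sym (hitWithin-away f f-away L) ⟩
      hitWithin v (suc L) f      ∎

  survival-uniform : ∀ v → ∃ λ N → ∀ e → survival v N e ≤ 1ℚ - η ^ N
  survival-uniform v =
    let N , bound = bounded-DE (λ e → length (proj₁ (proj₂ (leaves-every-vertex e v)))) in
    N , λ e → let g , p , g-at-v = leaves-every-vertex e v in begin
      survival v N e          ≤⟨ survival-antimono v (bound e) e ⟩
      survival v (length p) e ≤⟨ -‿antimonoʳ-≤ 1ℚ (hitWithin-along p g-at-v) ⟩
      1ℚ - η ^ length p       ≤⟨ -‿antimonoʳ-≤ 1ℚ (^-antimonoʳ 0≤η η≤1 (bound e)) ⟩
      1ℚ - η ^ N              ∎
    where open ≤-Reasoning

  survival-submultiplicative : ∀ v K {β} → (∀ g → survival v K g ≤ β) →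
    ∀ j e → survival v (j ℕ.+ suc K) e ≤ β * survival v j e
  survival-submultiplicative v K {β} bound zero e = begin
    survival v (suc K) e             ≡⟨ survival-suc v K e ⟩
    c e * P⟨ survival v K ⟩ e        ≤⟨ c*P⟨⟩-mono e bound ⟩
    c e * P⟨ (λ _ → β) ⟩ e           ≡⟨ trans (cong (c e *_) (P⟨⟩-const β e)) (*-comm (c e) β) ⟩
    β * survival v 0 e               ∎
    where
    open ≤-Reasoning
    c : DE G → ℚ
    c e = 1ℚ - at v e
    c*P⟨⟩-mono : ∀ e {F H} → (∀ f → F f ≤ H f) → c e * P⟨ F ⟩ e ≤ c e * P⟨ H ⟩ e
    c*P⟨⟩-mono e F≤H = *-monoˡ-≤-nonNeg (c e) {{nonNegative (1-δ-nonNeg (tl e) v)}} (P⟨⟩-mono F≤H e)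
  survival-submultiplicative v K {β} bound (suc j) e = begin
    survival v (suc (j ℕ.+ suc K)) e       ≡⟨ survival-suc v (j ℕ.+ suc K) e ⟩
    c * P⟨ survival v (j ℕ.+ suc K) ⟩ e    ≤⟨ *-monoˡ-≤-nonNeg c {{nonNegative (1-δ-nonNeg (tl e) v)}}
                                               (P⟨⟩-mono (survival-submultiplicative v K bound j) e) ⟩
    c * P⟨ (λ f → β * survival v j f) ⟩ e  ≡⟨ cong (c *_) (P⟨⟩-*ˡ β (survival v j) e) ⟩
    c * (β * P⟨ survival v j ⟩ e)          ≡⟨ solve 3 (λ c β x → c :* (β :* x) := β :* (c :* x)) refl c β _ ⟩
    β * (c * P⟨ survival v j ⟩ e)          ≡⟨ cong (β *_) (sym (survival-suc v j e)) ⟩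
    β * survival v (suc j) e               ∎
    where
    open ≤-Reasoning
    c : ℚ
    c = 1ℚ - at v e

  survival-geometric : ∀ v → ∃ λ N → ∀ k e → survival v (k ℕ.* suc N) e ≤ (1ℚ - η ^ N) ^ k
  survival-geometric v = N , geometric
    where
    N : ℕ
    N = proj₁ (survival-uniform v)
    0≤1-θ : 0ℚ ≤ 1ℚ - η ^ N
    0≤1-θ = p≤q⇒0≤q-p (^≤1 0≤η η≤1 N)
    geometric : ∀ k e → survival v (k ℕ.* suc N) e ≤ (1ℚ - η ^ N) ^ k
    geometric zero    e = -‿antimonoʳ-≤ 1ℚ (hitWithin-nonNeg v 0 e)
    geometric (suc k) e = begin
      survival v (suc N ℕ.+ k ℕ.* suc N) e
        ≡⟨ cong (λ t → survival v t e) (ℕₚ.+-comm (suc N) (k ℕ.* suc N)) ⟩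
      survival v (k ℕ.* suc N ℕ.+ suc N) e
        ≤⟨ survival-submultiplicative v N (proj₂ (survival-uniform v)) (k ℕ.* suc N) e ⟩
      (1ℚ - η ^ N) * survival v (k ℕ.* suc N) e
        ≤⟨ *-monoˡ-≤-nonNeg (1ℚ - η ^ N) {{nonNegative 0≤1-θ}} (geometric k e) ⟩
      (1ℚ - η ^ N) * (1ℚ - η ^ N) ^ k ∎
      where open ≤-Reasoning

  hitWithin→1 : ∀ v e → Converges (λ K → hitWithin v K e) 1ℚ
  hitWithin→1 v e tol 0<tol =
    let N , geometric = survival-geometric v
        k , small     = ^-small (^-pos (recip-pos-Fin v) N) (^≤1 0≤η η≤1 N) 0<tol
    in k ℕ.* suc N , λ K kN≤K → begin-strict
      ∣ hitWithin v K e - 1ℚ ∣    ≡⟨ distance K ⟩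
      survival v K e              ≤⟨ survival-antimono v kN≤K e ⟩
      survival v (k ℕ.* suc N) e  ≤⟨ geometric k e ⟩
      (1ℚ - η ^ N) ^ k            <⟨ small ⟩
      tol                         ∎
    where
    open ≤-Reasoning
    distance : ∀ K → ∣ hitWithin v K e - 1ℚ ∣ ≡ survival v K e
    distance K = begin-equality
      ∣ hitWithin v K e - 1ℚ ∣
        ≡⟨ cong ∣_∣ (solve 1 (λ u → u :- con 1ℚ := :- (con 1ℚ :- u)) refl (hitWithin v K e)) ⟩
      ∣ - survival v K e ∣
        ≡⟨ ∣-p∣≡∣p∣ (survival v K e) ⟩
      ∣ survival v K e ∣
        ≡⟨ 0≤p⇒∣p∣≡p (survival-nonNeg v K e) ⟩
      survival v K e ∎

  hitTimeWithin : Fin n → ℕ → DE G → ℚ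
  hitTimeWithin v K e = partial (λ k → ℕ→ℚ k * hitProb G v k e) K

  firstStep : Fin n → ℕ → DE G → ℚ
  firstStep v K = P⟨ (λ f → hitTimeWithin v K f + hitWithin v K f) ⟩

  firstStep-suc : ∀ v K e →
    firstStep v (suc K) e ≡ firstStep v K e + ℕ→ℚ (suc (suc K)) * P⟨ hitProb G v (suc K) ⟩ e
  firstStep-suc v K e = begin
    P⟨ (λ f → (A f + ℕ→ℚ (suc K) * h f) + (U f + h f)) ⟩ e
      ≡⟨ P⟨⟩-cong regroup e ⟩
    P⟨ (λ f → (A f + U f) + ℕ→ℚ (suc (suc K)) * h f) ⟩ e
      ≡⟨ P⟨⟩-+ _ _ e ⟩
    firstStep v K e + P⟨ (λ f → ℕ→ℚ (suc (suc K)) * h f) ⟩ e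
      ≡⟨ cong (firstStep v K e +_) (P⟨⟩-*ˡ (ℕ→ℚ (suc (suc K))) h e) ⟩
    firstStep v K e + ℕ→ℚ (suc (suc K)) * P⟨ h ⟩ e ∎
    where
    open ≡-Reasoning
    A U h : DE G → ℚ
    A = hitTimeWithin v K
    U = hitWithin v K
    h = hitProb G v (suc K)
    regroup : ∀ f → (A f + ℕ→ℚ (suc K) * h f) + (U f + h f) ≡ (A f + U f) + ℕ→ℚ (suc (suc K)) * h f
    regroup f = trans
      (solve 4 (λ a k x u → (a :+ k :* x) :+ (u :+ x) := (a :+ u) :+ (k :+ con 1ℚ) :* x)
             refl (A f) (ℕ→ℚ (suc K)) (h f) (U f))
      (cong (λ z → (A f + U f) + z * h f) (sym (ℕ→ℚ-suc (suc K))))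

  -- First-step analysis of a time-weighted partial sum; it applies to hitProb v
  -- with c = 1 - at v e and to retProb with c = 1.
  weightedPartial-suc : ∀ v c (s : ℕ → ℚ) e → (∀ k → s (suc k) ≡ c * P⟨ hitProb G v k ⟩ e) →
    ∀ K → partial (λ k → ℕ→ℚ k * s k) (suc K) ≡ c * firstStep v K e
  weightedPartial-suc v c s e s-suc zero = begin
    0ℚ * s 0 + 1ℚ * s 1             ≡⟨ cong (λ z → 0ℚ * s 0 + 1ℚ * z) (s-suc 0) ⟩
    0ℚ * s 0 + 1ℚ * (c * P⟨ h ⟩ e)  ≡⟨ solve 3 (λ s c x → con 0ℚ :* s :+ con 1ℚ :* (c :* x) := c :* x) refl (s 0) c _ ⟩
    c * P⟨ h ⟩ e                    ≡⟨ cong (c *_) (P⟨⟩-cong (λ f → solve 1 (λ x → x := con 0ℚ :* x :+ x) refl (h f)) e) ⟩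
    c * firstStep v 0 e             ∎
    where
    open ≡-Reasoning
    h : DE G → ℚ
    h = hitProb G v 0
  weightedPartial-suc v c s e s-suc (suc K) = begin
    partial (λ k → ℕ→ℚ k * s k) (suc K) + k * s (suc (suc K))
      ≡⟨ cong₂ (λ a b → a + k * b) (weightedPartial-suc v c s e s-suc K) (s-suc (suc K)) ⟩
    c * firstStep v K e + k * (c * X)
      ≡⟨ solve 4 (λ c a k x → c :* a :+ k :* (c :* x) := c :* (a :+ k :* x)) refl c (firstStep v K e) k X ⟩
    c * (firstStep v K e + k * X)
      ≡⟨ cong (c *_) (sym (firstStep-suc v K e)) ⟩
    c * firstStep v (suc K) e ∎
    where
    open ≡-Reasoning
    k X : ℚ
    k = ℕ→ℚ (suc (suc K))
    X = P⟨ hitProb G v (suc K) ⟩ e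

  module ExpectedHittingTimes (M : Mat (DE G) (Fin n)) (M-isMev : IsMev G M) where

    firstStep-converges : ∀ v e → Converges (λ K → firstStep v K e) (P⟨ (λ f → M f v + 1ℚ) ⟩ e)
    firstStep-converges v e = converges-∑ₑ λ f →
      converges-*ˡ (P e f) (converges-+ {λ K → hitTimeWithin v K f} (M-isMev f v) (hitWithin→1 v f))

    M-firstStep : ∀ e v → M e v ≡ (1ℚ - at v e) * P⟨ (λ f → M f v + 1ℚ) ⟩ e
    M-firstStep e v = converges-unique {λ K → hitTimeWithin v K e} (M-isMev e v)
      (converges-suc⁻ {λ K → hitTimeWithin v K e}
        (converges-cong {λ K → (1ℚ - at v e) * firstStep v K e}
          (λ K → sym (weightedPartial-suc v (1ℚ - at v e) (λ k → hitProb G v k e) e (λ _ → refl) K))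
          (converges-*ˡ (1ℚ - at v e) (firstStep-converges v e))))

    returnTime : DE G → ℚ
    returnTime e = P⟨ (λ f → M f (tl e) + 1ℚ) ⟩ e

    returnTime-isReturnTimes : IsReturnTimes G returnTime
    returnTime-isReturnTimes e = converges-suc⁻ {λ K → partial (λ k → ℕ→ℚ k * retProb G k e) K}
      (converges-cong {λ K → firstStep (tl e) K e}
        (λ K → sym (trans (weightedPartial-suc (tl e) 1ℚ (λ k → retProb G k e) e (λ _ → sym (*-identityˡ _)) K)
                          (*-identityˡ _)))
        (firstStep-converges (tl e) e))

    P⟨M+1⟩ : ∀ e v → P⟨ (λ f → M f v + 1ℚ) ⟩ e ≡ P⟨ (λ f → M f v) ⟩ e + 1ℚ
    P⟨M+1⟩ e v = trans (P⟨⟩-+ (λ f → M f v) (λ _ → 1ℚ) e) (cong (P⟨ (λ f → M f v) ⟩ e +_) (P⟨⟩-const 1ℚ e))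

    IminusP∙M : ∀ e v → (IminusP G ∙ₑ M) e v ≡ M e v - P⟨ (λ f → M f v) ⟩ e
    IminusP∙M e v = begin
      ∑ₑ (λ f → (Iₑ G e f - P e f) * M f v)
        ≡⟨ ∑ₑ-cong (λ f → *-distribʳ-- (M f v) (Iₑ G e f) (P e f)) ⟩
      ∑ₑ (λ f → Iₑ G e f * M f v - P e f * M f v)
        ≡⟨ ∑ₑ-- (λ f → Iₑ G e f * M f v) (λ f → P e f * M f v) ⟩
      ∑ₑ (λ f → Iₑ G e f * M f v) - P⟨ (λ f → M f v) ⟩ e
        ≡⟨ cong (_- P⟨ (λ f → M f v) ⟩ e) (∑ₑ-Iₑ e (λ f → M f v)) ⟩
      M e v - P⟨ (λ f → M f v) ⟩ e ∎
      where
      open ≡-Reasoning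
      *-distribʳ-- : ∀ m a b → (a - b) * m ≡ a * m - b * m
      *-distribʳ-- = solve 3 (λ m a b → (a :- b) :* m := a :* m :- b :* m) refl

    IminusP∙M-firstStep : ∀ e v →
      (IminusP G ∙ₑ M) e v ≡ (1ℚ - at v e) * (P⟨ (λ f → M f v) ⟩ e + 1ℚ) - P⟨ (λ f → M f v) ⟩ e
    IminusP∙M-firstStep e v =
      trans (IminusP∙M e v)
            (cong (_- P⟨ (λ f → M f v) ⟩ e) (trans (M-firstStep e v) (cong ((1ℚ - at v e) *_) (P⟨M+1⟩ e v))))

    IminusP∙M-tail : ∀ e → (IminusP G ∙ₑ M) e (tl e) ≡ 1ℚ - returnTime e
    IminusP∙M-tail e = begin
      (IminusP G ∙ₑ M) e (tl e)                       ≡⟨ IminusP∙M-firstStep e (tl e) ⟩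
      (1ℚ - at (tl e) e) * (X + 1ℚ) - X               ≡⟨ cong (λ c → (1ℚ - c) * (X + 1ℚ) - X) (δ-≡ {a = tl e} refl) ⟩
      (1ℚ - 1ℚ) * (X + 1ℚ) - X                        ≡⟨ solve 1 (λ x → (con 1ℚ :- con 1ℚ) :* (x :+ con 1ℚ) :- x
                                                                       := con 1ℚ :- (x :+ con 1ℚ)) refl X ⟩
      1ℚ - (X + 1ℚ)                                   ≡⟨ cong (λ z → 1ℚ - z) (sym (P⟨M+1⟩ e (tl e))) ⟩
      1ℚ - returnTime e                               ∎
      where
      open ≡-Reasoning
      X : ℚ
      X = P⟨ (λ f → M f (tl e)) ⟩ e

    IminusP∙M-away : ∀ e v → ¬ tl e ≡ v → (IminusP G ∙ₑ M) e v ≡ 1ℚ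
    IminusP∙M-away e v away = begin
      (IminusP G ∙ₑ M) e v                ≡⟨ IminusP∙M-firstStep e v ⟩
      (1ℚ - at v e) * (X + 1ℚ) - X        ≡⟨ cong (λ c → (1ℚ - c) * (X + 1ℚ) - X) (δ-≢ away) ⟩
      (1ℚ - 0ℚ) * (X + 1ℚ) - X            ≡⟨ solve 1 (λ x → (con 1ℚ :- con 0ℚ) :* (x :+ con 1ℚ) :- x := con 1ℚ) refl X ⟩
      1ℚ                                  ∎
      where
      open ≡-Reasoning
      X : ℚ
      X = P⟨ (λ f → M f v) ⟩ e

    IminusP∙M-constantOnTails : LocallyUniformReturn G → ConstantOnTails (IminusP G ∙ₑ M)
    IminusP∙M-constantOnTails uniform e e′ v same with tl e ≟ v
    ... | yes refl = begin
      (IminusP G ∙ₑ M) e (tl e)    ≡⟨ IminusP∙M-tail e ⟩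
      1ℚ - returnTime e            ≡⟨ cong (λ r → 1ℚ - r) (uniform returnTime returnTime-isReturnTimes e e′ same) ⟩
      1ℚ - returnTime e′           ≡⟨ sym (IminusP∙M-tail e′) ⟩
      (IminusP G ∙ₑ M) e′ (tl e′)  ≡⟨ cong ((IminusP G ∙ₑ M) e′) (sym same) ⟩
      (IminusP G ∙ₑ M) e′ (tl e)   ∎
      where open ≡-Reasoning
    ... | no away =
      trans (IminusP∙M-away e v away) (sym (IminusP∙M-away e′ v (λ e′-at-v → away (trans same e′-at-v))))

mainTheorem6 : ∀ (n : ℕ) (G : Graph n) → IsSimple G → Connected G → MinDegTwo G → ¬ IsCycle G
    → LocallyUniformReturn G
    → ∀ (Ze : Mat (DE G) (DE G)) → IsZe G Ze
    → ∀ (M : Mat (DE G) (Fin n)) → IsMev G M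
    → ∀ (x y : Fin n)
    → _·ₑ_ G (_·ₑ_ G (_·ᵥ_ G (Zv G Ze) (_·ᵥ_ G (Dinv G) (Tm G))) (IminusP G)) M x y
      ≡ _·ₑ_ G (_·ₑ_ G (_·ₑ_ G (_·ᵥ_ G (Dinv G) (Tm G)) Ze) (IminusP G)) M x y
mainTheorem6 n G (symmetric , _) connected minDeg _ uniform Ze _ M M-isMev x y = begin
  (Zv G Ze ∙ᵥ B ∙ₑ IminusP G ∙ₑ M) x y
    ≡⟨ ∙ₑ-assoc (Zv G Ze ∙ᵥ B) (IminusP G) M x y ⟩
  (Zv G Ze ∙ᵥ B ∙ₑ Y) x y
    ≡⟨ ∙ₑ-congˡ {X = Zv G Ze ∙ᵥ B} {B ∙ₑ Ze ∙ₑ (Tmᵀ G ∙ᵥ B)} Y x (λ g → ∙ₑ-∙ᵥ-assoc (B ∙ₑ Ze) (Tmᵀ G) B x g) y ⟩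
  (B ∙ₑ Ze ∙ₑ (Tmᵀ G ∙ᵥ B) ∙ₑ Y) x y
    ≡⟨ ∙ₑ-assoc (B ∙ₑ Ze) (Tmᵀ G ∙ᵥ B) Y x y ⟩
  (B ∙ₑ Ze ∙ₑ (Tmᵀ G ∙ᵥ B ∙ₑ Y)) x y
    ≡⟨ ∙ₑ-congʳ (B ∙ₑ Ze) {Tmᵀ G ∙ᵥ B ∙ₑ Y} {Y} y (λ h → tailAveraging-fixes Y Y-constant h y) x ⟩
  (B ∙ₑ Ze ∙ₑ Y) x y
    ≡⟨ sym (∙ₑ-assoc (B ∙ₑ Ze) (IminusP G) M x y) ⟩
  (B ∙ₑ Ze ∙ₑ IminusP G ∙ₑ M) x y ∎
  where
  open ≡-Reasoning
  open DirectedEdges G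
  open NonBacktrackingWalk G symmetric minDeg connected
  open ExpectedHittingTimes M M-isMev
  B : Mat (Fin n) (DE G)
  B = Dinv G ∙ᵥ Tm G
  Y : Mat (DE G) (Fin n)
  Y = IminusP G ∙ₑ M
  Y-constant : ConstantOnTails Y
  Y-constant = IminusP∙M-constantOnTails uniform
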